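{- For $n\geq 1$, \begin{equation*} \sum_{\pi\in\mathrm{PPF}_n}F_{n,\mathrm{Tie}(\pi)} =\sum_{i=1}^n (n-2)^{i-1}s_{(i,1^{n-i})}. \end{equation*}
   Context: A parking function of length $n$ is a sequence of positive integers whose increasing rearrangement $\lambda$ satisfies $\lambda_i\le i$; it is prime if removing any instance of 1 yields a parking function of length $n-1$. $\mathrm{PPF}_n$ denotes the set of prime parking functions of length $n$. $\mathrm{Tie}(\pi)=\{i\in[n-1]:\pi_i=\pi_{i+1}\}$. For $S\subseteq[n-1]$, $F_{n,S}=\sum_{1\le b_1\le\cdots\le b_n,\ i\in S\Rightarrow b_i<b_{i+1}} x_{b_1}\cdots x_{b_n}$ is Gessel's fundamental quasisymmetric function, and $s_{(i,1^{n-i})}$ is the Schur function of the hook partition $(i,1^{n-i})$. -}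

module Defs where

open import Data.Nat using (ℕ; zero; suc; _≤ᵇ_; _<ᵇ_; _≡ᵇ_; _∸_)
open import Data.Bool using (Bool; true; false; _∧_; _∨_; not; if_then_else_; T)
open import Data.List using (List; []; _∷_; [_]; map; concatMap; upTo; length; filterᵇ; foldr; _++_; allFin)
open import Data.Fin using (Fin; toℕ)
open import Data.Integer as ℤ using (ℤ)
open import Data.Product using (_×_; _,_)
open import Relation.Binary.PropositionalEquality using (_≡_)

allᵇ : {A : Set} → (A → Bool) → List A → Bool
allᵇ p = foldr (λ x b → p x ∧ b) true

sumℤ : List ℤ → ℤ
sumℤ = foldr ℤ._+_ (ℤ.+ 0)

vals : ℕ → List ℕ
vals m = map suc (upTo m)

words : ℕ → ℕ → List (List ℕ)
words zero    m = [ [] ]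
words (suc k) m = concatMap (λ v → map (v ∷_) (words k m)) (vals m)

insert : ℕ → List ℕ → List ℕ
insert x []       = x ∷ []
insert x (y ∷ ys) = if x ≤ᵇ y then x ∷ y ∷ ys else y ∷ insert x ys

sortInc : List ℕ → List ℕ
sortInc []       = []
sortInc (x ∷ xs) = insert x (sortInc xs)

boundedFrom : ℕ → List ℕ → Bool
boundedFrom i []       = true
boundedFrom i (x ∷ xs) = (x ≤ᵇ i) ∧ boundedFrom (suc i) xs

isParking : List ℕ → Bool
isParking π = allᵇ (λ x → 1 ≤ᵇ x) π ∧ boundedFrom 1 (sortInc π)

removeOne : List ℕ → List (List ℕ)
removeOne []       = []
removeOne (x ∷ xs) = (if x ≡ᵇ 1 then [ xs ] else []) ++ map (x ∷_) (removeOne xs)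

IsPPF : ℕ → List ℕ → Set
IsPPF n π = (length π ≡ n) × T (isParking π) × T (allᵇ isParking (removeOne π))

-- Tie set, as a membership predicate on positions i ∈ [n-1] (1-based)

lookup1 : List ℕ → ℕ → ℕ   -- 1-based lookup (0 outside range)
lookup1 []       _             = 0
lookup1 (x ∷ xs) zero          = 0
lookup1 (x ∷ xs) (suc zero)    = x
lookup1 (x ∷ xs) (suc (suc i)) = lookup1 xs (suc i)

Tie : List ℕ → ℕ → Bool
Tie π i = (1 ≤ᵇ i) ∧ (i <ᵇ length π) ∧ (lookup1 π i ≡ᵇ lookup1 π (suc i))

-- Monomials: the coefficient of x^α, α : Fin m → ℕ (exponent of x_{k+1}
-- is α k; every monomial lives in finitely many variables x_1..x_m).

count : ℕ → List ℕ → ℕ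
count v = length ∘′ filterᵇ (λ x → x ≡ᵇ v)
  where
  _∘′_ : {A B C : Set} → (B → C) → (A → B) → A → C
  (f ∘′ g) x = f (g x)

hasContent : (m : ℕ) → (Fin m → ℕ) → List ℕ → Bool
hasContent m α w = allᵇ (λ k → count (suc (toℕ k)) w ≡ᵇ α k) (allFin m)

fOK : (ℕ → Bool) → ℕ → List ℕ → Bool
fOK S i []           = true
fOK S i (x ∷ [])     = true
fOK S i (x ∷ y ∷ ys) =
  (if S i then x <ᵇ y else x ≤ᵇ y) ∧ fOK S (suc i) (y ∷ ys)

-- coefficient of x^α in F_{n,S}
FCoeff : ℕ → (ℕ → Bool) → (m : ℕ) → (Fin m → ℕ) → ℕ
FCoeff n S m α =
  length (filterᵇ (λ b → fOK S 1 b ∧ hasContent m α b) (words n m))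

-- A semistandard tableau of this shape = first row r = (r_1,…,r_i),
-- weakly increasing, and the remaining column entries c = (c_1,…,c_{n-i})
-- below r_1, with r_1 < c_1 < ⋯ < c_{n-i}.

weakInc : List ℕ → Bool
weakInc = fOK (λ _ → false) 1

strictInc : List ℕ → Bool
strictInc = fOK (λ _ → true) 1

headLt : List ℕ → List ℕ → Bool
headLt (r ∷ _) (c ∷ _) = r <ᵇ c
headLt _       _       = true

isHookSSYT : List ℕ → List ℕ → Bool
isHookSSYT r c = weakInc r ∧ strictInc c ∧ headLt r c

-- coefficient of x^α in s_{(i,1^{n-i})}
hookCoeff : ℕ → ℕ → (m : ℕ) → (Fin m → ℕ) → ℕ
hookCoeff n i m α =
  length (filterᵇ (λ rc → isHookSSYT (proj₁' rc) (proj₂' rc)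
                        ∧ hasContent m α (proj₁' rc ++ proj₂' rc))
          (concatMap (λ r → map (r ,_) (words (n ∸ i) m)) (words i m)))
  where
  proj₁' : List ℕ × List ℕ → List ℕ
  proj₁' (a , _) = a
  proj₂' : List ℕ × List ℕ → List ℕ
  proj₂' (_ , b) = b

-- Write n = K + 1 with K ≥ 1 (n = 1 is a direct check) and compare coefficients of x^α. The
-- left side counts pairs (π, b) with π ∈ PPF_n and b a word of content α that is weakly
-- increasing and strictly increasing at the positions of Tie(π). A prime parking function of
-- length K + 1 is a word over [K], and the cyclic shifts x ↦ x − p (mod K), which preserve ties,
-- carry every word w over [K] to exactly one prime parking function: the shift by the last
-- minimiser p of #{i : w_i ≤ p} − p. So K times the left side counts pairs (w, b) with w ∈ [K]^n
-- arbitrary; summing over w first gives b the weight K ∏ (K, K − 1 or 0) over its ascents,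
-- plateaus and descents. Only the sorted word of content α survives. With x = K − 1 = n − 2 its
-- weight is K x^(n−1−a) (1 + x)^a, where a is its number of ascents, and expanding (1 + x)^a over
-- the subsets c of the ascent tops matches the hook tableaux of shape (n − |c|, 1^|c|) with first
-- column c below the corner. This is K times the right side.

module Submission where

open import Defs

module Counting where

  open import Data.Bool using (Bool; true; false; _∧_; if_then_else_; T)
  open import Data.Bool.Properties using (T-∧; if-float)
  open import Data.Empty using (⊥)
  open import Data.Fin using (Fin; toℕ; fromℕ<)
  open import Data.Fin.Properties using (toℕ-fromℕ<)
  open import Data.List using (List; []; _∷_; [_]; map; _++_; length; filter; concatMap; cartesianProductWith; upTo; allFin)
  open import Data.List.Membership.Propositional using (_∈_; _∉_; find; lose)
  open import Data.List.Membership.Propositional.Properties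
    using (∈-map⁺; ∈-map⁻; ∈-++⁺ˡ; ∈-++⁺ʳ; ∈-++⁻; ∈-upTo⁺; ∈-upTo⁻; ∈-filter⁺; ∈-filter⁻; ∈-allFin;
           ∈-cartesianProductWith⁺; ∈-cartesianProductWith⁻)
  open import Data.List.Membership.Propositional.Properties.WithK using (unique∧set⇒bag)
  open import Data.List.Properties
    using (map-++; map-∘; map-id; map-cong-local; length-map; length-++; length-upTo; length-filter;
           filter-++; filter-all; filter-none; filter-some; filter-accept; filter-complete; ∷-injective; ∷-injectiveʳ; ≡-dec)
  open import Data.List.Relation.Binary.BagAndSetEquality using (∼bag⇒↭)
  open import Data.List.Relation.Binary.Permutation.Propositional using (_↭_; ↭-refl; ↭-sym; ↭-trans; prep; swap)
  open import Data.List.Relation.Binary.Permutation.Propositional.Properties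
    using (↭-length; filter-↭; All-resp-↭; ++-comm; shift; ++⁺ˡ)
  import Data.List.Relation.Binary.Permutation.Propositional.Properties as ↭
  open import Data.List.Relation.Unary.All as All using (All; []; _∷_)
  import Data.List.Relation.Unary.All.Properties as All
  open import Data.List.Relation.Unary.AllPairs as AllPairs using (AllPairs; []; _∷_; allPairs?)
  open import Data.List.Relation.Unary.Any as Any using (here; there; any?)
  open import Data.List.Relation.Unary.Linked using (Linked; []; [-]; _∷_)
  open import Data.List.Relation.Unary.Linked.Properties using (Linked⇒AllPairs; AllPairs⇒Linked)
  open import Data.List.Relation.Unary.Unique.Propositional using (Unique)
  open import Data.List.Relation.Unary.Unique.Propositional.Properties using (++⁺; cartesianProductWith⁺; filter⁺; map⁺; map⁻; upTo⁺)
  import Data.List.Sort.InsertionSort.Base as InsertionSort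
  import Data.List.Sort.InsertionSort.Properties as InsertionSortₚ
  open import Data.Nat
  open import Data.Nat.ListAction using (sum)
  open import Data.Nat.ListAction.Properties using (sum-++; sum-↭)
  open import Data.Nat.Properties
  open import Algebra.Properties.CommutativeSemigroup +-commutativeSemigroup
    using () renaming (interchange to +-interchange; x∙yz≈y∙xz to +-exchange)
  open import Algebra.Properties.CommutativeSemigroup *-commutativeSemigroup
    using () renaming (x∙yz≈y∙xz to *-exchange)
  open import Data.Nat.Tactic.RingSolver using (solve-∀)
  open import Data.Product using (_×_; _,_; proj₁; proj₂; ∃-syntax)
  open import Data.Sum using (inj₁; inj₂)
  open import Function using (_∘_)
  open import Function.Bundles using (_⇔_; mk⇔; Equivalence)
  open import Relation.Binary.Definitions using (DecidableEquality; tri<; tri≈; tri>)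
  open import Relation.Binary.PropositionalEquality hiding ([_])
  open import Relation.Nullary using (¬_; yes; no; does; contradiction; _×-dec_)
  open import Relation.Nullary.Decidable using (T?; dec-true; dec-false)
  open import Relation.Unary using (Decidable)

  -- Sums over lists

  ∑ : {A : Set} → List A → (A → ℕ) → ℕ
  ∑ xs f = sum (map f xs)

  syntax ∑ xs (λ x → e) = ∑[ x ← xs ] e

  𝟙 : Bool → ℕ
  𝟙 true  = 1
  𝟙 false = 0

  𝟙-∧ : ∀ a b → 𝟙 (a ∧ b) ≡ 𝟙 a * 𝟙 b
  𝟙-∧ true  b = sym (+-identityʳ (𝟙 b))
  𝟙-∧ false b = refl

  𝟙-true : ∀ {b} → T b → 𝟙 b ≡ 1
  𝟙-true {true} _ = refl

  𝟙-false : ∀ {b} → ¬ T b → 𝟙 b ≡ 0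
  𝟙-false {true}  ¬b = contradiction _ ¬b
  𝟙-false {false} _  = refl

  module _ {A : Set} where

    ∑-++ : (xs ys : List A) (f : A → ℕ) → ∑ (xs ++ ys) f ≡ ∑ xs f + ∑ ys f
    ∑-++ xs ys f = trans (cong sum (map-++ f xs ys)) (sum-++ (map f xs) (map f ys))

    ∑-↭ : {xs ys : List A} (f : A → ℕ) → xs ↭ ys → ∑ xs f ≡ ∑ ys f
    ∑-↭ f p = sum-↭ (↭.map⁺ f p)

    ∑-cong : (xs : List A) {f g : A → ℕ} → (∀ {x} → x ∈ xs → f x ≡ g x) → ∑ xs f ≡ ∑ xs g
    ∑-cong xs f≡g = cong sum (map-cong-local (All.tabulate f≡g))

    ∑-congʳ : (xs : List A) {f g : A → ℕ} → (∀ x → f x ≡ g x) → ∑ xs f ≡ ∑ xs g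
    ∑-congʳ xs f≡g = ∑-cong xs (λ {x} _ → f≡g x)

    ∑-zero : (xs : List A) {f : A → ℕ} → (∀ {x} → x ∈ xs → f x ≡ 0) → ∑ xs f ≡ 0
    ∑-zero []       f≡0 = refl
    ∑-zero (x ∷ xs) f≡0 = cong₂ _+_ (f≡0 (here refl)) (∑-zero xs (f≡0 ∘ there))

    ∑-const : (xs : List A) (k : ℕ) → ∑[ _ ← xs ] k ≡ length xs * k
    ∑-const []       k = refl
    ∑-const (x ∷ xs) k = cong (k +_) (∑-const xs k)

    ∑-+ : (xs : List A) (f g : A → ℕ) → ∑[ x ← xs ] (f x + g x) ≡ ∑ xs f + ∑ xs g
    ∑-+ []       f g = refl
    ∑-+ (x ∷ xs) f g = trans (cong (f x + g x +_) (∑-+ xs f g)) (+-interchange (f x) (g x) _ _)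

    ∑-*ˡ : (k : ℕ) (xs : List A) (f : A → ℕ) → ∑[ x ← xs ] (k * f x) ≡ k * ∑ xs f
    ∑-*ˡ k []       f = sym (*-zeroʳ k)
    ∑-*ˡ k (x ∷ xs) f = trans (cong (k * f x +_) (∑-*ˡ k xs f)) (sym (*-distribˡ-+ k (f x) _))

    ∑-*ʳ : (xs : List A) (f : A → ℕ) (k : ℕ) → ∑[ x ← xs ] (f x * k) ≡ ∑ xs f * k
    ∑-*ʳ []       f k = refl
    ∑-*ʳ (x ∷ xs) f k = trans (cong (f x * k +_) (∑-*ʳ xs f k)) (sym (*-distribʳ-+ k (f x) _))

    ∑-single : (xs : List A) (f : A → ℕ) {x₀ : A} → Unique xs → x₀ ∈ xs →
               (∀ {x} → x ∈ xs → x ≢ x₀ → f x ≡ 0) → ∑ xs f ≡ f x₀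
    ∑-single (x ∷ xs) f (x∉xs ∷ _) (here refl) f≡0 =
      trans (cong (f x +_) (∑-zero xs (λ y∈ → f≡0 (there y∈) (All.lookup x∉xs y∈ ∘ sym)))) (+-identityʳ (f x))
    ∑-single (x ∷ xs) f (x∉xs ∷ xs!) (there x₀∈) f≡0 =
      cong₂ _+_ (f≡0 (here refl) (All.lookup x∉xs x₀∈)) (∑-single xs f xs! x₀∈ (f≡0 ∘ there))

    ∑-filter : {P : A → Set} (P? : Decidable P) (xs : List A) (f : A → ℕ) →
               ∑ (filter P? xs) f ≡ ∑[ x ← xs ] (𝟙 (does (P? x)) * f x)
    ∑-filter P? []       f = refl
    ∑-filter P? (x ∷ xs) f with does (P? x)
    ... | true  = cong₂ _+_ (sym (+-identityʳ (f x))) (∑-filter P? xs f)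
    ... | false = ∑-filter P? xs f

    length≡∑ : (xs : List A) → length xs ≡ ∑[ _ ← xs ] 1
    length≡∑ xs = sym (trans (∑-const xs 1) (*-identityʳ (length xs)))

    length-filter≡∑ : {P : A → Set} (P? : Decidable P) (xs : List A) →
                      length (filter P? xs) ≡ ∑[ x ← xs ] 𝟙 (does (P? x))
    length-filter≡∑ P? xs = trans (length≡∑ (filter P? xs))
      (trans (∑-filter P? xs (λ _ → 1)) (∑-congʳ xs (λ x → *-identityʳ (𝟙 (does (P? x))))))

    filter-nonempty : {P : A → Set} (P? : Decidable P) (xs : List A) → 1 ≤ length (filter P? xs) → ∃[ x ] (x ∈ xs × P x)
    filter-nonempty P? (x ∷ xs) pos with P? x
    ... | yes px = x , here refl , px
    ... | no  _  = let y , y∈ , py = filter-nonempty P? xs pos in y , there y∈ , py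

    ∑-unique-bag : {xs ys : List A} → Unique xs → Unique ys → (∀ z → z ∈ xs ⇔ z ∈ ys) →
                   (f : A → ℕ) → ∑ xs f ≡ ∑ ys f
    ∑-unique-bag xs! ys! xs≈ys f = ∑-↭ f (∼bag⇒↭ (unique∧set⇒bag xs! ys! (λ {z} → xs≈ys z)))

  ∑-map : {A B : Set} (g : A → B) (xs : List A) (f : B → ℕ) → ∑ (map g xs) f ≡ ∑[ x ← xs ] f (g x)
  ∑-map g xs f = cong sum (sym (map-∘ xs))

  ∑-comm : {A B : Set} (xs : List A) (ys : List B) (f : A → B → ℕ) →
           ∑[ x ← xs ] ∑[ y ← ys ] f x y ≡ ∑[ y ← ys ] ∑[ x ← xs ] f x y
  ∑-comm []       ys f = sym (∑-zero ys (λ _ → refl))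
  ∑-comm (x ∷ xs) ys f =
    trans (cong (∑ ys (f x) +_) (∑-comm xs ys f)) (sym (∑-+ ys (f x) (λ y → ∑[ x′ ← xs ] f x′ y)))

  ∑-cartesianProductWith : {A B C : Set} (g : A → B → C) (xs : List A) (ys : List B) (f : C → ℕ) →
    ∑ (cartesianProductWith g xs ys) f ≡ ∑[ x ← xs ] ∑[ y ← ys ] f (g x y)
  ∑-cartesianProductWith g []       ys f = refl
  ∑-cartesianProductWith g (x ∷ xs) ys f = begin
    ∑ (map (g x) ys ++ cartesianProductWith g xs ys) f
      ≡⟨ ∑-++ (map (g x) ys) _ f ⟩
    ∑ (map (g x) ys) f + ∑ (cartesianProductWith g xs ys) f
      ≡⟨ cong₂ _+_ (∑-map (g x) ys f) (∑-cartesianProductWith g xs ys f) ⟩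
    ∑[ y ← ys ] f (g x y) + ∑[ x′ ← xs ] ∑[ y ← ys ] f (g x′ y) ∎
    where open ≡-Reasoning

  ∑-if-≡ᵇ : (xs : List ℕ) → Unique xs → ∀ {u} → u ∈ xs → (a c : ℕ) →
            ∑[ v ← xs ] (if v ≡ᵇ u then a else c) ≡ a + (length xs ∸ 1) * c
  ∑-if-≡ᵇ (x ∷ xs) (x∉xs ∷ _) (here refl) a c = begin
      (if x ≡ᵇ x then a else c) + ∑[ v ← xs ] (if v ≡ᵇ x then a else c)
    ≡⟨ cong₂ _+_ (cong (if_then a else c) (dec-true (x ≟ x) refl))
                 (∑-cong xs (λ v∈ → cong (if_then a else c) (dec-false (_ ≟ x) (All.lookup x∉xs v∈ ∘ sym)))) ⟩
      a + ∑[ _ ← xs ] c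
    ≡⟨ cong (a +_) (∑-const xs c) ⟩
      a + length xs * c ∎
    where open ≡-Reasoning
  ∑-if-≡ᵇ (x ∷ y ∷ ys) (x∉xs ∷ xs!) (there u∈) a c = begin
      (if x ≡ᵇ _ then a else c) + ∑[ v ← y ∷ ys ] (if v ≡ᵇ _ then a else c)
    ≡⟨ cong₂ _+_ (cong (if_then a else c) (dec-false (x ≟ _) (All.lookup x∉xs u∈))) (∑-if-≡ᵇ (y ∷ ys) xs! u∈ a c) ⟩
      c + (a + length ys * c)
    ≡⟨ +-exchange c a _ ⟩
      a + (c + length ys * c) ∎
    where open ≡-Reasoning

  module _ {A : Set} (_≟_ : DecidableEquality A) where

    open import Data.List.Membership.DecPropositional _≟_ using (_∈?_)

    ∑-∈?-comm : ∀ {xs ys} → Unique xs → Unique ys →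
                ∑[ x ← xs ] 𝟙 (does (x ∈? ys)) ≡ ∑[ y ← ys ] 𝟙 (does (y ∈? xs))
    ∑-∈?-comm {xs} {ys} xs! ys! = begin
      ∑[ x ← xs ] 𝟙 (does (x ∈? ys))  ≡⟨ sym (length-filter≡∑ (_∈? ys) xs) ⟩
      length (filter (_∈? ys) xs)     ≡⟨ length≡∑ (filter (_∈? ys) xs) ⟩
      ∑[ _ ← filter (_∈? ys) xs ] 1   ≡⟨ ∑-unique-bag (filter⁺ (_∈? ys) xs!) (filter⁺ (_∈? xs) ys!)
                                                     (λ _ → mk⇔ (in-both xs ys) (in-both ys xs)) (λ _ → 1) ⟩
      ∑[ _ ← filter (_∈? xs) ys ] 1   ≡⟨ sym (length≡∑ (filter (_∈? xs) ys)) ⟩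
      length (filter (_∈? xs) ys)     ≡⟨ length-filter≡∑ (_∈? xs) ys ⟩
      ∑[ y ← ys ] 𝟙 (does (y ∈? xs))  ∎
      where
      open ≡-Reasoning
      in-both : ∀ zs ws {z} → z ∈ filter (_∈? ws) zs → z ∈ filter (_∈? zs) ws
      in-both zs ws z∈ = let z∈zs , z∈ws = ∈-filter⁻ (_∈? ws) {xs = zs} z∈ in ∈-filter⁺ (_∈? zs) z∈ws z∈zs

  -- Words and tie-compatibility

  Letter : ℕ → ℕ → Set
  Letter m x = 1 ≤ x × x ≤ m

  ∈-vals⁺ : ∀ {m x} → Letter m x → x ∈ vals m
  ∈-vals⁺ {x = suc x} (_ , x<m) = ∈-map⁺ suc (∈-upTo⁺ x<m)

  ∈-vals⁻ : ∀ {m x} → x ∈ vals m → Letter m x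
  ∈-vals⁻ x∈ with ∈-map⁻ suc x∈
  ... | _ , y∈ , refl = s≤s z≤n , ∈-upTo⁻ y∈

  vals-unique : ∀ m → Unique (vals m)
  vals-unique m = map⁺ suc-injective (upTo⁺ m)

  length-vals : ∀ m → length (vals m) ≡ m
  length-vals m = trans (length-map suc (upTo m)) (length-upTo m)

  concatMap≡cartesianProductWith : {A B C : Set} (f : A → B → C) (xs : List A) (ys : List B) →
    concatMap (λ x → map (f x) ys) xs ≡ cartesianProductWith f xs ys
  concatMap≡cartesianProductWith f []       ys = refl
  concatMap≡cartesianProductWith f (x ∷ xs) ys = cong (map (f x) ys ++_) (concatMap≡cartesianProductWith f xs ys)

  words-suc : ∀ k m → words (suc k) m ≡ cartesianProductWith _∷_ (vals m) (words k m)
  words-suc k m = concatMap≡cartesianProductWith _∷_ (vals m) (words k m)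

  ∈-words⁺ : ∀ {k m w} → length w ≡ k → All (Letter m) w → w ∈ words k m
  ∈-words⁺ {w = []}    refl []         = here refl
  ∈-words⁺ {suc k} {m} {x ∷ w} refl (x∈ ∷ w∈) = subst (x ∷ w ∈_) (sym (words-suc k m))
    (∈-cartesianProductWith⁺ _∷_ (∈-vals⁺ x∈) (∈-words⁺ refl w∈))

  ∈-words⁻ : ∀ k m {w} → w ∈ words k m → length w ≡ k × All (Letter m) w
  ∈-words⁻ zero    m (here refl) = refl , []
  ∈-words⁻ (suc k) m w∈ with ∈-cartesianProductWith⁻ _∷_ (vals m) (words k m) (subst (_ ∈_) (words-suc k m) w∈)
  ... | x , w , x∈ , w∈ , refl = cong suc (proj₁ (∈-words⁻ k m w∈)) , ∈-vals⁻ x∈ ∷ proj₂ (∈-words⁻ k m w∈)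

  length-words : ∀ k m {w} → w ∈ words k m → length w ≡ k
  length-words k m = proj₁ ∘ ∈-words⁻ k m

  letters-words : ∀ k m {w} → w ∈ words k m → All (Letter m) w
  letters-words k m = proj₂ ∘ ∈-words⁻ k m

  words-unique : ∀ k m → Unique (words k m)
  words-unique zero    m = [] ∷ []
  words-unique (suc k) m = subst Unique (sym (words-suc k m))
    (cartesianProductWith⁺ _∷_ ∷-injective (vals-unique m) (words-unique k m))

  ∑-words-suc : ∀ k m (f : List ℕ → ℕ) → ∑ (words (suc k) m) f ≡ ∑[ v ← vals m ] ∑[ w ← words k m ] f (v ∷ w)
  ∑-words-suc k m f = trans (cong (λ ws → ∑ ws f) (words-suc k m)) (∑-cartesianProductWith _∷_ (vals m) (words k m) f)

  map-left-inverse : {A B : Set} {P : A → Set} (f : A → B) (g : B → A) → (∀ {x} → P x → g (f x) ≡ x) →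
                     ∀ {xs} → All P xs → map g (map f xs) ≡ xs
  map-left-inverse f g g∘f {xs} Pxs = trans (sym (map-∘ xs)) (trans (map-cong-local (All.map g∘f Pxs)) (map-id xs))

  module _ (m : ℕ) {f g : ℕ → ℕ}
           (f-letter : ∀ {x} → Letter m x → Letter m (f x))
           (g-letter : ∀ {x} → Letter m x → Letter m (g x))
           (g∘f : ∀ {x} → Letter m x → g (f x) ≡ x)
           (f∘g : ∀ {x} → Letter m x → f (g x) ≡ x) where

    ∑-words-map : ∀ k (h : List ℕ → ℕ) → ∑[ w ← words k m ] h (map f w) ≡ ∑ (words k m) h
    ∑-words-map k h = trans (sym (∑-map (map f) ws h)) (∑-unique-bag image-unique (words-unique k m) (λ _ → mk⇔ to from) h)
      where
      ws = words k m
      image-unique : Unique (map (map f) ws)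
      image-unique = map⁻ (subst Unique (sym (map-left-inverse (map f) (map g)
        (λ w∈ → map-left-inverse f g g∘f (letters-words k m w∈)) (All.tabulate (λ w∈ → w∈)))) (words-unique k m))
      to : ∀ {z} → z ∈ map (map f) ws → z ∈ ws
      to z∈ with ∈-map⁻ (map f) z∈
      ... | w , w∈ , refl = ∈-words⁺ (trans (length-map f w) (length-words k m w∈)) (All.map⁺ (All.map f-letter (letters-words k m w∈)))
      from : ∀ {z} → z ∈ ws → z ∈ map (map f) ws
      from {z} z∈ = subst (_∈ map (map f) ws) (map-left-inverse g f f∘g (letters-words k m z∈))
        (∈-map⁺ (map f) (∈-words⁺ (trans (length-map g z) (length-words k m z∈)) (All.map⁺ (All.map g-letter (letters-words k m z∈)))))

  fOK-cong : ∀ {S S′ : ℕ → Bool} → (∀ j → S j ≡ S′ j) → ∀ i b → fOK S i b ≡ fOK S′ i b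
  fOK-cong S≗S′ i []           = refl
  fOK-cong S≗S′ i (x ∷ [])     = refl
  fOK-cong S≗S′ i (x ∷ y ∷ b) =
    cong₂ _∧_ (cong (if_then x <ᵇ y else x ≤ᵇ y) (S≗S′ i)) (fOK-cong S≗S′ (suc i) (y ∷ b))

  fOK-Tie-∷ : ∀ v w i b → fOK (Tie (v ∷ w)) (suc (suc i)) b ≡ fOK (Tie w) (suc i) b
  fOK-Tie-∷ v w i []          = refl
  fOK-Tie-∷ v w i (x ∷ [])    = refl
  fOK-Tie-∷ v w i (x ∷ y ∷ b) = cong (_ ∧_) (fOK-Tie-∷ v w (suc i) (y ∷ b))

  stepWeight : ℕ → ℕ → ℕ → ℕ
  stepWeight K x y = if x <ᵇ y then K else if x ≡ᵇ y then K ∸ 1 else 0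

  weight : ℕ → List ℕ → ℕ
  weight K []           = 1
  weight K (x ∷ [])     = K
  weight K (x ∷ y ∷ b) = stepWeight K x y * weight K (y ∷ b)

  stepWeight-split : ∀ K x y → 1 ≤ K → 𝟙 (x <ᵇ y) + (K ∸ 1) * 𝟙 (x ≤ᵇ y) ≡ stepWeight K x y
  stepWeight-split (suc K) x y _ with <-cmp x y
  ... | tri< x<y _ _
    rewrite dec-true (x <? y) x<y | dec-true (x ≤? y) (<⇒≤ x<y) = cong suc (*-identityʳ K)
  ... | tri≈ x≮y refl _
    rewrite dec-false (x <? x) x≮y | dec-true (x ≟ x) refl | dec-true (x ≤? x) ≤-refl = *-identityʳ K
  ... | tri> x≮y x≢y y<x
    rewrite dec-false (x <? y) x≮y | dec-false (x ≟ y) x≢y | dec-false (x ≤? y) (<⇒≱ y<x) = *-zeroʳ K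

  tiedStep : ℕ → ℕ → ℕ → List ℕ → Bool
  tiedStep x y v (u ∷ _) = if v ≡ᵇ u then x <ᵇ y else x ≤ᵇ y
  tiedStep x y v []      = x ≤ᵇ y

  ∑-tied : ∀ {K x y n w} → 1 ≤ K → All (Letter K) w → length w ≡ suc n →
           ∑[ v ← vals K ] 𝟙 (tiedStep x y v w) ≡ stepWeight K x y
  ∑-tied {K} {x} {y} {w = u ∷ w} 1≤K (u∈ ∷ _) _ = begin
      ∑[ v ← vals K ] 𝟙 (if v ≡ᵇ u then x <ᵇ y else x ≤ᵇ y)
    ≡⟨ ∑-congʳ (vals K) (λ v → if-float 𝟙 (v ≡ᵇ u)) ⟩
      ∑[ v ← vals K ] (if v ≡ᵇ u then 𝟙 (x <ᵇ y) else 𝟙 (x ≤ᵇ y))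
    ≡⟨ ∑-if-≡ᵇ (vals K) (vals-unique K) (∈-vals⁺ u∈) _ _ ⟩
      𝟙 (x <ᵇ y) + (length (vals K) ∸ 1) * 𝟙 (x ≤ᵇ y)
    ≡⟨ cong (λ k → 𝟙 (x <ᵇ y) + (k ∸ 1) * 𝟙 (x ≤ᵇ y)) (length-vals K) ⟩
      𝟙 (x <ᵇ y) + (K ∸ 1) * 𝟙 (x ≤ᵇ y)
    ≡⟨ stepWeight-split K x y 1≤K ⟩
      stepWeight K x y ∎
    where open ≡-Reasoning

  ∑-compatible≡weight : ∀ n K b → 1 ≤ K → length b ≡ n →
                        ∑[ w ← words n K ] 𝟙 (fOK (Tie w) 1 b) ≡ weight K b
  ∑-compatible≡weight zero          K []      _   refl = refl
  ∑-compatible≡weight (suc zero)    K (x ∷ []) _  refl = begin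
    ∑[ w ← words 1 K ] 1   ≡⟨ ∑-words-suc 0 K _ ⟩
    ∑[ v ← vals K ] 1      ≡⟨ ∑-const (vals K) 1 ⟩
    length (vals K) * 1   ≡⟨ *-identityʳ _ ⟩
    length (vals K)       ≡⟨ length-vals K ⟩
    K                     ∎
    where open ≡-Reasoning
  ∑-compatible≡weight (suc (suc n)) K (x ∷ y ∷ b) 1≤K refl = begin
      ∑[ w ← words (suc (suc n)) K ] 𝟙 (fOK (Tie w) 1 (x ∷ y ∷ b))
    ≡⟨ ∑-words-suc (suc n) K _ ⟩
      ∑[ v ← vals K ] ∑[ w ← words (suc n) K ] 𝟙 (fOK (Tie (v ∷ w)) 1 (x ∷ y ∷ b))
    ≡⟨ ∑-congʳ (vals K) (λ v → ∑-cong (words (suc n) K) (λ w∈ → first-step v (length-words (suc n) K w∈))) ⟩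
      ∑[ v ← vals K ] ∑[ w ← words (suc n) K ] (𝟙 (tied v w) * 𝟙 (fOK (Tie w) 1 (y ∷ b)))
    ≡⟨ ∑-comm (vals K) (words (suc n) K) (λ v w → 𝟙 (tied v w) * 𝟙 (fOK (Tie w) 1 (y ∷ b))) ⟩
      ∑[ w ← words (suc n) K ] ∑[ v ← vals K ] (𝟙 (tied v w) * 𝟙 (fOK (Tie w) 1 (y ∷ b)))
    ≡⟨ ∑-cong (words (suc n) K) (λ w∈ → trans (∑-*ʳ (vals K) _ _)
         (cong (_* _) (∑-tied 1≤K (letters-words (suc n) K w∈) (length-words (suc n) K w∈)))) ⟩
      ∑[ w ← words (suc n) K ] (stepWeight K x y * 𝟙 (fOK (Tie w) 1 (y ∷ b)))
    ≡⟨ ∑-*ˡ (stepWeight K x y) (words (suc n) K) _ ⟩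
      stepWeight K x y * ∑[ w ← words (suc n) K ] 𝟙 (fOK (Tie w) 1 (y ∷ b))
    ≡⟨ cong (stepWeight K x y *_) (∑-compatible≡weight (suc n) K (y ∷ b) 1≤K refl) ⟩
      stepWeight K x y * weight K (y ∷ b) ∎
    where
    open ≡-Reasoning
    tied = tiedStep x y
    first-step : ∀ v {w} → length w ≡ suc n →
      𝟙 (fOK (Tie (v ∷ w)) 1 (x ∷ y ∷ b)) ≡ 𝟙 (tied v w) * 𝟙 (fOK (Tie w) 1 (y ∷ b))
    first-step v {u ∷ w} _ = trans (cong (λ c → 𝟙 (tied v (u ∷ w) ∧ c)) (fOK-Tie-∷ v (u ∷ w) 0 (y ∷ b))) (𝟙-∧ (tied v (u ∷ w)) _)

  -- Parking functions

  private
    module Sort = InsertionSort ≤-decTotalOrder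
    module Sortₚ = InsertionSortₚ ≤-decTotalOrder

  Sorted : List ℕ → Set
  Sorted = AllPairs _≤_

  insert≡ : ∀ x xs → insert x xs ≡ Sort.insert x xs
  insert≡ x []       = refl
  insert≡ x (y ∷ ys) = cong (if x ≤ᵇ y then x ∷ y ∷ ys else_) (cong (y ∷_) (insert≡ x ys))

  sortInc≡sort : ∀ xs → sortInc xs ≡ Sort.sort xs
  sortInc≡sort []       = refl
  sortInc≡sort (x ∷ xs) = trans (insert≡ x (sortInc xs)) (cong (Sort.insert x) (sortInc≡sort xs))

  sortInc-↭ : ∀ xs → sortInc xs ↭ xs
  sortInc-↭ xs = subst (_↭ xs) (sym (sortInc≡sort xs)) (Sortₚ.sort-↭ xs)

  sortInc-sorted : ∀ xs → Sorted (sortInc xs)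
  sortInc-sorted xs = subst Sorted (sym (sortInc≡sort xs)) (Linked⇒AllPairs ≤-trans (Sortₚ.sort-↗ xs))

  allᵇ⇔All : {A : Set} (p : A → Bool) (xs : List A) → T (allᵇ p xs) ⇔ All (T ∘ p) xs
  allᵇ⇔All p xs = mk⇔ (to xs) (from xs)
    where
    to : ∀ xs → T (allᵇ p xs) → All (T ∘ p) xs
    to []       _ = []
    to (x ∷ xs) t = let px , pxs = Equivalence.to T-∧ t in px ∷ to xs pxs
    from : ∀ xs → All (T ∘ p) xs → T (allᵇ p xs)
    from []       []         = _
    from (x ∷ xs) (px ∷ pxs) = Equivalence.from T-∧ (px , from xs pxs)

  count≤ : ℕ → List ℕ → ℕ
  count≤ j xs = length (filter (_≤? j) xs)

  count≤-∷ : ∀ {j x} xs → x ≤ j → count≤ j (x ∷ xs) ≡ suc (count≤ j xs)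
  count≤-∷ xs x≤j = cong length (filter-accept (_≤? _) x≤j)

  count≤-↭ : ∀ j {xs ys} → xs ↭ ys → count≤ j xs ≡ count≤ j ys
  count≤-↭ j xs↭ys = ↭-length (filter-↭ (_≤? j) xs↭ys)

  count≤-all : ∀ {j xs} → All (_≤ j) xs → count≤ j xs ≡ length xs
  count≤-all all≤ = cong length (filter-all (_≤? _) all≤)

  count≤-full : ∀ {j} xs → length xs ≤ count≤ j xs → All (_≤ j) xs
  count≤-full {j} xs full =
    subst (All (_≤ j)) (filter-complete (_≤? j) (≤-antisym (length-filter (_≤? j) xs) full)) (All.all-filter (_≤? j) xs)

  count≤-pos : ∀ {j} xs → 1 ≤ count≤ j xs → ∃[ x ] (x ∈ xs × x ≤ j)
  count≤-pos {j} xs = filter-nonempty (_≤? j) xs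

  count≤-none : ∀ {j xs} → All (j <_) xs → count≤ j xs ≡ 0
  count≤-none all> = cong length (filter-none (_≤? _) (All.map <⇒≱ all>))

  boundedFrom⇒counts : ∀ i l → Sorted l → T (boundedFrom (suc i) l) →
                       ∀ j → i < j → j ≤ i + length l → j ≤ i + count≤ j l
  boundedFrom⇒counts i []      _          _ j i<j j≤ = contradiction (<-≤-trans i<j j≤) (<-irrefl (sym (+-identityʳ i)))
  boundedFrom⇒counts i (x ∷ l) (x≤l ∷ l↑) b j i<j j≤ with Equivalence.to T-∧ b
  ... | x≤i , b′ rewrite count≤-∷ l (≤-trans (≤ᵇ⇒≤ x (suc i) x≤i) i<j) | +-suc i (count≤ j l)
    with m≤n⇒m<n∨m≡n i<j
  ... | inj₂ refl = s≤s (m≤m+n i _)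
  ... | inj₁ i<j′ = boundedFrom⇒counts (suc i) l l↑ b′ j i<j′ (subst (j ≤_) (+-suc i (length l)) j≤)

  counts⇒boundedFrom : ∀ i l → Sorted l → (∀ j → i < j → j ≤ i + length l → j ≤ i + count≤ j l) →
                       T (boundedFrom (suc i) l)
  counts⇒boundedFrom i []      _          _      = _
  counts⇒boundedFrom i (x ∷ l) (x≤l ∷ l↑) counts = Equivalence.from T-∧ (≤⇒≤ᵇ x≤i , counts⇒boundedFrom (suc i) l l↑ counts′)
    where
    x≤i : x ≤ suc i
    x≤i = ≮⇒≥ λ i<x → <⇒≱ (n<1+n i) (begin
      suc i                      ≤⟨ counts (suc i) ≤-refl (subst (suc i ≤_) (sym (+-suc i (length l))) (s≤s (m≤m+n i _))) ⟩
      i + count≤ (suc i) (x ∷ l) ≡⟨ cong (i +_) (count≤-none (i<x ∷ All.map (<-≤-trans i<x) x≤l)) ⟩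
      i + 0                      ≡⟨ +-identityʳ i ⟩
      i                          ∎)
      where open ≤-Reasoning
    counts′ : ∀ j → suc i < j → j ≤ suc i + length l → j ≤ suc i + count≤ j l
    counts′ j i<j j≤ = subst (j ≤_) (trans (cong (i +_) (count≤-∷ l (≤-trans x≤i (<⇒≤ i<j)))) (+-suc i _))
      (counts j (<⇒≤ i<j) (subst (j ≤_) (sym (+-suc i _)) j≤))

  ParkingCounts : List ℕ → Set
  ParkingCounts π = All (1 ≤_) π × (∀ j → 1 ≤ j → j ≤ length π → j ≤ count≤ j π)

  isParking⇔ : ∀ π → T (isParking π) ⇔ ParkingCounts π
  isParking⇔ π = mk⇔ to from
    where
    π↑ = sortInc-↭ π
    to : T (isParking π) → ParkingCounts π
    to t with Equivalence.to T-∧ t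
    ... | pos , b = All.map (≤ᵇ⇒≤ 1 _) (Equivalence.to (allᵇ⇔All _ π) pos) , λ j 1≤j j≤ →
      subst (j ≤_) (count≤-↭ j π↑)
        (boundedFrom⇒counts 0 (sortInc π) (sortInc-sorted π) b j 1≤j (subst (j ≤_) (sym (↭-length π↑)) j≤))
    from : ParkingCounts π → T (isParking π)
    from (pos , counts) = Equivalence.from T-∧ (Equivalence.from (allᵇ⇔All _ π) (All.map ≤⇒≤ᵇ pos) ,
      counts⇒boundedFrom 0 (sortInc π) (sortInc-sorted π) λ j 1≤j j≤ →
        subst (j ≤_) (sym (count≤-↭ j π↑)) (counts j 1≤j (subst (j ≤_) (↭-length π↑) j≤)))

  removeOne-↭ : ∀ π {ρ} → ρ ∈ removeOne π → π ↭ 1 ∷ ρ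
  removeOne-↭ (x ∷ π) ρ∈ with x ≡ᵇ 1 in x≡1
  removeOne-↭ (x ∷ π) (here refl) | true rewrite ≡ᵇ⇒≡ x 1 (subst T (sym x≡1) _) = ↭-refl
  removeOne-↭ (x ∷ π) (there ρ∈)  | true  = removeOne-↭-∷ ρ∈
    where
    removeOne-↭-∷ : ∀ {ρ} → ρ ∈ map (x ∷_) (removeOne π) → x ∷ π ↭ 1 ∷ ρ
    removeOne-↭-∷ ρ∈ with ∈-map⁻ (x ∷_) ρ∈
    ... | ρ′ , ρ′∈ , refl = ↭-trans (prep x (removeOne-↭ π ρ′∈)) (swap x 1 ↭-refl)
  removeOne-↭ (x ∷ π) ρ∈ | false with ∈-map⁻ (x ∷_) ρ∈
  ... | ρ′ , ρ′∈ , refl = ↭-trans (prep x (removeOne-↭ π ρ′∈)) (swap x 1 ↭-refl)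

  removeOne-nonempty : ∀ {π} → 1 ∈ π → ∃[ ρ ] ρ ∈ removeOne π
  removeOne-nonempty {x ∷ π} (here refl) = π , here refl
  removeOne-nonempty {x ∷ π} (there 1∈π) with removeOne-nonempty 1∈π
  ... | ρ , ρ∈ = x ∷ ρ , ∈-++⁺ʳ (if x ≡ᵇ 1 then [ π ] else []) (∈-map⁺ (x ∷_) ρ∈)

  count≤-removeOne : ∀ π {ρ j} → ρ ∈ removeOne π → 1 ≤ j → count≤ j π ≡ suc (count≤ j ρ)
  count≤-removeOne π {ρ} {j} ρ∈ 1≤j = trans (count≤-↭ j (removeOne-↭ π ρ∈)) (count≤-∷ ρ 1≤j)

  PrimeCounts : ℕ → List ℕ → Set
  PrimeCounts K π = ∀ j → 1 ≤ j → j < K → suc j ≤ count≤ j π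

  isPPF? : ∀ n → Decidable (IsPPF n)
  isPPF? n π = (length π ≟ n) ×-dec (T? (isParking π) ×-dec T? (allᵇ isParking (removeOne π)))

  IsPPF⇒PrimeCounts : ∀ K π → 1 ≤ K → IsPPF (suc K) π → π ∈ words (suc K) K × PrimeCounts K π
  IsPPF⇒PrimeCounts K π 1≤K (length-π , park , removed) =
    ∈-words⁺ length-π (All.zip (pos , all≤K)) , λ j 1≤j j<K → counts j 1≤j (<⇒≤ j<K)
    where
    parkπ = Equivalence.to (isParking⇔ π) park
    pos = proj₁ parkπ
    one-in-π : 1 ∈ π
    one-in-π with count≤-pos π (proj₂ parkπ 1 ≤-refl (subst (1 ≤_) (sym length-π) (s≤s z≤n)))
    ... | x , x∈ , x≤1 = subst (_∈ π) (≤-antisym x≤1 (All.lookup pos x∈)) x∈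
    ρ = proj₁ (removeOne-nonempty one-in-π)
    ρ∈ = proj₂ (removeOne-nonempty one-in-π)
    parkρ = Equivalence.to (isParking⇔ ρ) (All.lookup (Equivalence.to (allᵇ⇔All isParking (removeOne π)) removed) ρ∈)
    length-ρ : length ρ ≡ K
    length-ρ = suc-injective (trans (sym (↭-length (removeOne-↭ π ρ∈))) length-π)
    counts : ∀ j → 1 ≤ j → j ≤ K → suc j ≤ count≤ j π
    counts j 1≤j j≤K = subst (suc j ≤_) (sym (count≤-removeOne π ρ∈ 1≤j))
      (s≤s (proj₂ parkρ j 1≤j (subst (j ≤_) (sym length-ρ) j≤K)))
    all≤K : All (_≤ K) π
    all≤K = count≤-full π (subst (_≤ count≤ K π) (sym length-π) (counts K 1≤K ≤-refl))

  PrimeCounts⇒IsPPF : ∀ K π → π ∈ words (suc K) K → PrimeCounts K π → IsPPF (suc K) π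
  PrimeCounts⇒IsPPF K π π∈ prime = length-π , park , Equivalence.from (allᵇ⇔All isParking (removeOne π)) (All.tabulate removed)
    where
    length-π = length-words (suc K) K π∈
    letters = letters-words (suc K) K π∈
    counts : ∀ j → 1 ≤ j → j ≤ K → suc j ≤ count≤ j π
    counts j 1≤j j≤K with m≤n⇒m<n∨m≡n j≤K
    ... | inj₁ j<K = prime j 1≤j j<K
    ... | inj₂ refl = ≤-reflexive (sym (trans (count≤-all (All.map proj₂ letters)) length-π))
    park : T (isParking π)
    park = Equivalence.from (isParking⇔ π) (All.map proj₁ letters , park-counts)
      where
      park-counts : ∀ j → 1 ≤ j → j ≤ length π → j ≤ count≤ j π
      park-counts j 1≤j j≤ with m≤n⇒m<n∨m≡n (subst (j ≤_) length-π j≤)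
      ... | inj₁ j≤K = <⇒≤ (counts j 1≤j (s≤s⁻¹ j≤K))
      ... | inj₂ refl = ≤-reflexive (sym (trans (count≤-all (All.map (λ (_ , x≤K) → m≤n⇒m≤1+n x≤K) letters)) length-π))
    removed : ∀ {ρ} → ρ ∈ removeOne π → T (isParking ρ)
    removed {ρ} ρ∈ = Equivalence.from (isParking⇔ ρ)
      (All.tail (All-resp-↭ (removeOne-↭ π ρ∈) (All.map proj₁ letters)) , λ j 1≤j j≤ →
        s≤s⁻¹ (subst (suc j ≤_) (count≤-removeOne π ρ∈ 1≤j) (counts j 1≤j (subst (j ≤_) length-ρ j≤))))
      where
      length-ρ : length ρ ≡ K
      length-ρ = suc-injective (trans (sym (↭-length (removeOne-↭ π ρ∈))) length-π)

  IsPPF⇔PrimeCounts : ∀ K π → 1 ≤ K → IsPPF (suc K) π ⇔ (π ∈ words (suc K) K × PrimeCounts K π)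
  IsPPF⇔PrimeCounts K π 1≤K = mk⇔ (IsPPF⇒PrimeCounts K π 1≤K) (λ (π∈ , prime) → PrimeCounts⇒IsPPF K π π∈ prime)

  -- The cyclic lemma

  Tie-map : ∀ {P : ℕ → Set} (f : ℕ → ℕ) → (∀ {x y} → P x → P y → f x ≡ f y → x ≡ y) →
            ∀ {w} → All P w → ∀ i → Tie (map f w) i ≡ Tie w i
  Tie-map f f-inj {[]}         _                zero          = refl
  Tie-map f f-inj {[]}         _                (suc i)       = refl
  Tie-map f f-inj {x ∷ w}      _                zero          = refl
  Tie-map f f-inj {x ∷ []}     _                (suc zero)    = refl
  Tie-map f f-inj {x ∷ y ∷ w}  (px ∷ py ∷ _)    (suc zero) with x ≟ y
  ... | yes refl = trans (dec-true (f x ≟ f x) refl) (sym (dec-true (x ≟ x) refl))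
  ... | no  x≢y  = trans (dec-false (f x ≟ f y) (x≢y ∘ f-inj px py)) (sym (dec-false (x ≟ y) x≢y))
  Tie-map f f-inj {x ∷ w}      (_ ∷ pw)         (suc (suc i)) = Tie-map f f-inj pw (suc i)

  -- the cyclic shift x ↦ x − p (mod K) of [1, K]
  rotate : ℕ → ℕ → ℕ → ℕ
  rotate K p x = if p <ᵇ x then x ∸ p else x + K ∸ p

  rotate-above : ∀ K p {y} → 1 ≤ y → rotate K p (p + y) ≡ y
  rotate-above K p {y} 1≤y rewrite dec-true (p <? p + y) (m<m+n p 1≤y) = m+n∸m≡n p y

  rotate-below : ∀ {K p q x} → p + q ≡ K → x ≤ p → rotate K p x ≡ x + q
  rotate-below {K} {p} {q} {x} refl x≤p rewrite dec-false (p <? x) (≤⇒≯ x≤p) =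
    trans (cong (_∸ p) (x+[p+q]≡p+[x+q] x p q)) (m+n∸m≡n p (x + q))
    where
    x+[p+q]≡p+[x+q] : ∀ x p q → x + (p + q) ≡ p + (x + q)
    x+[p+q]≡p+[x+q] = solve-∀

  data Split (p q : ℕ) : ℕ → Set where
    below : ∀ {x} → x ≤ p → Split p q x
    above : ∀ {y} → 1 ≤ y → y ≤ q → Split p q (p + y)

  split : ∀ p q {x} → x ≤ p + q → Split p q x
  split p q {x} x≤p+q with x ≤? p
  ... | yes x≤p = below x≤p
  ... | no  x≰p = subst (Split p q) (m+[n∸m]≡n (<⇒≤ p<x))
                    (above (m<n⇒0<n∸m p<x) (subst (x ∸ p ≤_) (m+n∸m≡n p q) (∸-monoˡ-≤ p x≤p+q)))
    where p<x = ≰⇒> x≰p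

  rotate-letter : ∀ {K p q x} → p + q ≡ K → Letter K x → Letter K (rotate K p x)
  rotate-letter {p = p} {q} refl (1≤x , x≤) with split p q x≤
  ... | below x≤p rewrite rotate-below {q = q} refl x≤p = ≤-trans 1≤x (m≤m+n _ q) , +-monoˡ-≤ q x≤p
  ... | above {y} 1≤y y≤q rewrite rotate-above (p + q) p 1≤y = 1≤y , ≤-trans y≤q (m≤n+m q p)

  rotate-rotate : ∀ {K p q x} → p + q ≡ K → Letter K x → rotate K q (rotate K p x) ≡ x
  rotate-rotate {p = p} {q} refl (1≤x , x≤) with split p q x≤
  ... | below {x} x≤p rewrite rotate-below {q = q} refl x≤p | +-comm x q = rotate-above (p + q) q 1≤x
  ... | above {y} 1≤y y≤q rewrite rotate-above (p + q) p 1≤y | rotate-below {q = p} (+-comm q p) y≤q = +-comm y p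

  module _ (C : ℕ → ℕ) where

    infix 4 _≼_ _≺_

    -- a ≼ b says C a − a ≤ C b − b in ℤ
    _≼_ : ℕ → ℕ → Set
    a ≼ b = C a + b ≤ C b + a

    _≺_ : ℕ → ℕ → Set
    a ≺ b = C a + b < C b + a

    private
      regroupˡ : ∀ x y z u → (x + y) + (z + u) ≡ (x + u) + (z + y)
      regroupˡ = solve-∀
      regroupʳ : ∀ x y z u → (x + y) + (z + u) ≡ (z + y) + (x + u)
      regroupʳ = solve-∀

    ≼-trans : ∀ {a b c} → a ≼ b → b ≼ c → a ≼ c
    ≼-trans {a} {b} {c} a≼b b≼c = +-cancelʳ-≤ (C b + b) _ _ (begin
      (C a + c) + (C b + b) ≡⟨ regroupˡ (C a) c (C b) b ⟩
      (C a + b) + (C b + c) ≤⟨ +-mono-≤ a≼b b≼c ⟩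
      (C b + a) + (C c + b) ≡⟨ regroupʳ (C b) a (C c) b ⟩
      (C c + a) + (C b + b) ∎)
      where open ≤-Reasoning

    ≼-≺-trans : ∀ {a b c} → a ≼ b → b ≺ c → a ≺ c
    ≼-≺-trans {a} {b} {c} a≼b b≺c = +-cancelʳ-< (C b + b) _ _ (begin-strict
      (C a + c) + (C b + b) ≡⟨ regroupˡ (C a) c (C b) b ⟩
      (C a + b) + (C b + c) <⟨ +-mono-≤-< a≼b b≺c ⟩
      (C b + a) + (C c + b) ≡⟨ regroupʳ (C b) a (C c) b ⟩
      (C c + a) + (C b + b) ∎)
      where open ≤-Reasoning

    LastMinimiser : ℕ → ℕ → Set
    LastMinimiser N p = (∀ t → t < p → p ≼ t) × (∀ t → p < t → t < N → p ≺ t)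

    lastMinimiser-exists : ∀ N → 1 ≤ N → ∃[ p ] (p < N × LastMinimiser N p)
    lastMinimiser-exists (suc zero)    _ = 0 , s≤s z≤n , (λ _ ()) , λ t 0<t t<1 → contradiction t<1 (<⇒≱ (s≤s 0<t))
    lastMinimiser-exists (suc (suc N)) _ with lastMinimiser-exists (suc N) (s≤s z≤n)
    ... | p , p<N , before , after with C (suc N) + p ≤? C p + suc N
    ... | yes N≼p = suc N , ≤-refl , N≼ , λ t N<t t<N → contradiction t<N (<⇒≱ (s≤s N<t))
      where
      N≼ : ∀ t → t < suc N → suc N ≼ t
      N≼ t t<N with <-cmp t p
      ... | tri< t<p _ _ = ≼-trans N≼p (before t t<p)
      ... | tri≈ _ refl _ = N≼p
      ... | tri> _ _ p<t = <⇒≤ (≼-≺-trans N≼p (after t p<t t<N))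
    ... | no  N⋠p = p , m<n⇒m<1+n p<N , before , after′
      where
      after′ : ∀ t → p < t → t < suc (suc N) → p ≺ t
      after′ t p<t t<N with m≤n⇒m<n∨m≡n (s≤s⁻¹ t<N)
      ... | inj₁ t<N  = after t p<t t<N
      ... | inj₂ refl = ≰⇒> N⋠p

    lastMinimiser-unique : ∀ {N p p′} → LastMinimiser N p → LastMinimiser N p′ → p < N → p′ < N → p ≡ p′
    lastMinimiser-unique {p = p} {p′} (before , after) (before′ , after′) p<N p′<N with <-cmp p p′
    ... | tri≈ _ p≡p′ _ = p≡p′
    ... | tri< p<p′ _ _ = contradiction (before′ p p<p′) (<⇒≱ (after p′ p<p′ p′<N))
    ... | tri> _ _ p′<p = contradiction (before p′ p′<p) (<⇒≱ (after′ p p′<p p<N))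

  ≤ᵇ-+ˡ : ∀ p {y j} → (p + y ≤ᵇ p + j) ≡ (y ≤ᵇ j)
  ≤ᵇ-+ˡ p {y} {j} with y ≤? j
  ... | yes y≤j = trans (dec-true (p + y ≤? p + j) (+-monoʳ-≤ p y≤j)) (sym (dec-true (y ≤? j) y≤j))
  ... | no  y≰j = trans (dec-false (p + y ≤? p + j) (y≰j ∘ +-cancelˡ-≤ p y j)) (sym (dec-false (y ≤? j) y≰j))

  count≤≡∑ : ∀ j xs → count≤ j xs ≡ ∑[ x ← xs ] 𝟙 (x ≤ᵇ j)
  count≤≡∑ j xs = length-filter≡∑ (_≤? j) xs

  count≤-map : ∀ j (f : ℕ → ℕ) xs → count≤ j (map f xs) ≡ ∑[ x ← xs ] 𝟙 (f x ≤ᵇ j)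
  count≤-map j f xs = trans (count≤≡∑ j (map f xs)) (∑-map f xs _)

  module _ {p q : ℕ} where

    private
      K = p + q
      r = rotate K p

    𝟙-rotate-low : ∀ {j x} → j ≤ q → Letter K x → 𝟙 (r x ≤ᵇ j) + 𝟙 (x ≤ᵇ p) ≡ 𝟙 (x ≤ᵇ p + j)
    𝟙-rotate-low {j} j≤q (1≤x , x≤K) with split p q x≤K
    ... | below {x} x≤p rewrite rotate-below {q = q} refl x≤p
                              | dec-false (x + q ≤? j) (<⇒≱ (≤-<-trans j≤q (m<n+m q 1≤x)))
                              | dec-true (x ≤? p) x≤p
                              | dec-true (x ≤? p + j) (≤-trans x≤p (m≤m+n p j)) = refl
    ... | above {y} 1≤y _ rewrite rotate-above K p 1≤y
                                | dec-false (p + y ≤? p) (<⇒≱ (m<m+n p 1≤y))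
                                | ≤ᵇ-+ˡ p {y} {j} = +-identityʳ _

    𝟙-rotate-high : ∀ {t x} → t < p → Letter K x → 𝟙 (r x ≤ᵇ q + t) + 𝟙 (x ≤ᵇ p) ≡ 1 + 𝟙 (x ≤ᵇ t)
    𝟙-rotate-high {t} t<p (1≤x , x≤K) with split p q x≤K
    ... | below {x} x≤p rewrite rotate-below {q = q} refl x≤p
                              | +-comm x q | ≤ᵇ-+ˡ q {x} {t}
                              | dec-true (x ≤? p) x≤p = +-comm _ 1
    ... | above {y} 1≤y y≤q rewrite rotate-above K p 1≤y
                                  | dec-true (y ≤? q + t) (≤-trans y≤q (m≤m+n q t))
                                  | dec-false (p + y ≤? p) (<⇒≱ (m<m+n p 1≤y))
                                  | dec-false (p + y ≤? t) (<⇒≱ (<-≤-trans t<p (m≤m+n p y))) = refl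

    module _ {w : List ℕ} (w-letters : All (Letter K) w) where

      private
        C : ℕ → ℕ
        C t = count≤ t w
        R = map r w

      count≤-rotate-low : ∀ {j} → j ≤ q → count≤ j R + C p ≡ C (p + j)
      count≤-rotate-low {j} j≤q = begin
        count≤ j R + C p                              ≡⟨ cong₂ _+_ (count≤-map j r w) (count≤≡∑ p w) ⟩
        ∑[ x ← w ] 𝟙 (r x ≤ᵇ j) + ∑[ x ← w ] 𝟙 (x ≤ᵇ p) ≡⟨ sym (∑-+ w _ _) ⟩
        ∑[ x ← w ] (𝟙 (r x ≤ᵇ j) + 𝟙 (x ≤ᵇ p))         ≡⟨ ∑-cong w (λ x∈ → 𝟙-rotate-low j≤q (All.lookup w-letters x∈)) ⟩
        ∑[ x ← w ] 𝟙 (x ≤ᵇ p + j)                      ≡⟨ sym (count≤≡∑ (p + j) w) ⟩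
        C (p + j)                                     ∎
        where open ≡-Reasoning

      count≤-rotate-high : ∀ {t} → t < p → count≤ (q + t) R + C p ≡ length w + C t
      count≤-rotate-high {t} t<p = begin
        count≤ (q + t) R + C p                              ≡⟨ cong₂ _+_ (count≤-map (q + t) r w) (count≤≡∑ p w) ⟩
        ∑[ x ← w ] 𝟙 (r x ≤ᵇ q + t) + ∑[ x ← w ] 𝟙 (x ≤ᵇ p) ≡⟨ sym (∑-+ w _ _) ⟩
        ∑[ x ← w ] (𝟙 (r x ≤ᵇ q + t) + 𝟙 (x ≤ᵇ p))         ≡⟨ ∑-cong w (λ x∈ → 𝟙-rotate-high t<p (All.lookup w-letters x∈)) ⟩
        ∑[ x ← w ] (1 + 𝟙 (x ≤ᵇ t))                         ≡⟨ ∑-+ w (λ _ → 1) _ ⟩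
        ∑[ _ ← w ] 1 + ∑[ x ← w ] 𝟙 (x ≤ᵇ t)                ≡⟨ cong₂ _+_ (sym (length≡∑ w)) (sym (count≤≡∑ t w)) ⟩
        length w + C t                                      ∎
        where open ≡-Reasoning

      prime-low : ∀ {j} → j ≤ q → suc j ≤ count≤ j R ⇔ _≺_ C p (p + j)
      prime-low {j} j≤q = mk⇔
        (λ h → begin
          suc (C p + (p + j)) ≡⟨ regroup (C p) p j ⟩
          suc j + C p + p     ≤⟨ +-monoˡ-≤ p (+-monoˡ-≤ (C p) h) ⟩
          count≤ j R + C p + p ≡⟨ cong (_+ p) (count≤-rotate-low j≤q) ⟩
          C (p + j) + p       ∎)
        (λ h → +-cancelʳ-≤ (C p) _ _ (+-cancelʳ-≤ p _ _ (begin
          suc j + C p + p     ≡⟨ sym (regroup (C p) p j) ⟩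
          suc (C p + (p + j)) ≤⟨ h ⟩
          C (p + j) + p       ≡⟨ cong (_+ p) (sym (count≤-rotate-low j≤q)) ⟩
          count≤ j R + C p + p ∎)))
        where
        open ≤-Reasoning
        regroup : ∀ c p j → suc (c + (p + j)) ≡ suc j + c + p
        regroup = solve-∀

      module _ (length-w : length w ≡ suc K) where

        prime-high : ∀ {t} → t < p → suc (q + t) ≤ count≤ (q + t) R ⇔ _≼_ C p t
        prime-high {t} t<p = mk⇔
          (λ h → +-cancelʳ-≤ (suc q) _ _ (begin
            C p + t + suc q         ≡⟨ regroupˡ (C p) q t ⟩
            suc (q + t) + C p       ≤⟨ +-monoˡ-≤ (C p) h ⟩
            count≤ (q + t) R + C p  ≡⟨ high ⟩
            suc K + C t             ≡⟨ regroupʳ (C t) p q ⟩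
            C t + p + suc q         ∎))
          (λ h → +-cancelʳ-≤ (C p) _ _ (begin
            suc (q + t) + C p       ≡⟨ sym (regroupˡ (C p) q t) ⟩
            C p + t + suc q         ≤⟨ +-monoˡ-≤ (suc q) h ⟩
            C t + p + suc q         ≡⟨ sym (regroupʳ (C t) p q) ⟩
            suc K + C t             ≡⟨ sym high ⟩
            count≤ (q + t) R + C p  ∎))
          where
          open ≤-Reasoning
          high = trans (count≤-rotate-high t<p) (cong (_+ C t) length-w)
          regroupˡ : ∀ c q t → c + t + suc q ≡ suc (q + t) + c
          regroupˡ = solve-∀
          regroupʳ : ∀ c p q → suc (p + q) + c ≡ c + p + suc q
          regroupʳ = solve-∀

        C-zero : C 0 ≡ 0
        C-zero = count≤-none (All.map proj₁ w-letters)

        C-top : C K ≡ suc K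
        C-top = trans (count≤-all (All.map proj₂ w-letters)) length-w

        ≺-top : (∀ t → t < p → _≼_ C p t) → _≺_ C p K
        ≺-top before = begin-strict
            C p + K        ≤⟨ +-monoˡ-≤ K C-p≤p ⟩
            p + K          ≡⟨ +-comm p K ⟩
            K + p          <⟨ n<1+n (K + p) ⟩
            suc K + p      ≡⟨ cong (_+ p) (sym C-top) ⟩
            C K + p        ∎
          where
          open ≤-Reasoning
          C-p≤p : C p ≤ p
          C-p≤p with m≤n⇒m<n∨m≡n (z≤n {p})
          ... | inj₁ 0<p  = subst (_≤ p) (+-identityʳ (C p)) (subst (C p + 0 ≤_) (cong (_+ p) C-zero) (before 0 0<p))
          ... | inj₂ refl = ≤-reflexive C-zero

        prime⇔lastMinimiser : 1 ≤ q → PrimeCounts K R ⇔ LastMinimiser C K p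
        prime⇔lastMinimiser 1≤q = mk⇔ to from
          where
          to : PrimeCounts K R → LastMinimiser C K p
          to prime = before , after
            where
            before : ∀ t → t < p → _≼_ C p t
            before t t<p = Equivalence.to (prime-high t<p)
              (prime (q + t) (≤-trans 1≤q (m≤m+n q t)) (subst (q + t <_) (+-comm q p) (+-monoʳ-< q t<p)))
            after : ∀ t → p < t → t < K → _≺_ C p t
            after t p<t t<K with split p q (<⇒≤ t<K)
            ... | below t≤p = contradiction t≤p (<⇒≱ p<t)
            ... | above {j} 1≤j j≤q = Equivalence.to (prime-low j≤q)
              (prime j 1≤j (<-≤-trans (+-cancelˡ-< p j q t<K) (m≤n+m q p)))
          from : LastMinimiser C K p → PrimeCounts K R
          from (before , after) j 1≤j j<K with split q p (subst (j ≤_) (+-comm p q) (<⇒≤ j<K))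
          ... | below j≤q with m≤n⇒m<n∨m≡n j≤q
          ...   | inj₁ j<q  = Equivalence.from (prime-low j≤q) (after (p + j) (m<m+n p 1≤j) (+-monoʳ-< p j<q))
          ...   | inj₂ refl = Equivalence.from (prime-low ≤-refl) (≺-top before)
          from (before , after) _ _ j<K | above {t} _ _ =
            Equivalence.from (prime-high t<p) (before t t<p)
            where t<p = +-cancelˡ-< q t p (subst (q + t <_) (+-comm p q) j<K)

  rotation-PPF⇔lastMinimiser : ∀ {K p w} → 1 ≤ K → p < K → w ∈ words (suc K) K →
    IsPPF (suc K) (map (rotate K p) w) ⇔ LastMinimiser (λ t → count≤ t w) K p
  rotation-PPF⇔lastMinimiser {K} {p} {w} 1≤K p<K w∈ with m≤n⇒∃[o]m+o≡n (<⇒≤ p<K)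
  ... | q , refl = mk⇔
    (Equivalence.to min⇔ ∘ proj₂ ∘ Equivalence.to ppf⇔)
    (λ min → Equivalence.from ppf⇔ (R∈ , Equivalence.from min⇔ min))
    where
    letters = letters-words (suc K) K w∈
    R = map (rotate K p) w
    R∈ : R ∈ words (suc K) K
    R∈ = ∈-words⁺ (trans (length-map _ w) (length-words (suc K) K w∈)) (All.map⁺ (All.map (rotate-letter refl) letters))
    ppf⇔ = IsPPF⇔PrimeCounts K R 1≤K
    min⇔ = prime⇔lastMinimiser letters (length-words (suc K) K w∈) (+-cancelˡ-< p 0 q (subst (_< p + q) (sym (+-identityʳ p)) p<K))

  exactly-one-rotation-PPF : ∀ {K w} → 1 ≤ K → w ∈ words (suc K) K →
    ∑[ p ← upTo K ] 𝟙 (does (isPPF? (suc K) (map (rotate K p) w))) ≡ 1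
  exactly-one-rotation-PPF {K} {w} 1≤K w∈ with lastMinimiser-exists (λ t → count≤ t w) K 1≤K
  ... | p₀ , p₀<K , p₀-min = trans
    (∑-single (upTo K) _ (upTo⁺ K) (∈-upTo⁺ p₀<K) others)
    (cong 𝟙 (dec-true (isPPF? (suc K) (map (rotate K p₀) w)) (Equivalence.from (rotation-PPF⇔lastMinimiser 1≤K p₀<K w∈) p₀-min)))
    where
    others : ∀ {p} → p ∈ upTo K → p ≢ p₀ → 𝟙 (does (isPPF? (suc K) (map (rotate K p) w))) ≡ 0
    others {p} p∈ p≢p₀ = cong 𝟙 (dec-false (isPPF? (suc K) (map (rotate K p) w)) λ ppf → p≢p₀
      (lastMinimiser-unique _ (Equivalence.to (rotation-PPF⇔lastMinimiser 1≤K (∈-upTo⁻ p∈) w∈) ppf) p₀-min (∈-upTo⁻ p∈) p₀<K))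

  module _ {K p : ℕ} (p<K : p < K) where

    private
      q = K ∸ p
      p+q≡K : p + q ≡ K
      p+q≡K = m+[n∸m]≡n (<⇒≤ p<K)
      q+p≡K : q + p ≡ K
      q+p≡K = trans (+-comm q p) p+q≡K

    ∑-words-rotate : ∀ n (h : List ℕ → ℕ) → ∑[ w ← words n K ] h (map (rotate K p) w) ≡ ∑ (words n K) h
    ∑-words-rotate = ∑-words-map K (rotate-letter p+q≡K) (rotate-letter q+p≡K) (rotate-rotate p+q≡K) (rotate-rotate q+p≡K)

    Tie-rotate : ∀ {w} → All (Letter K) w → ∀ i → Tie (map (rotate K p) w) i ≡ Tie w i
    Tie-rotate = Tie-map (rotate K p) λ x∈ y∈ eq →
      trans (sym (rotate-rotate p+q≡K x∈)) (trans (cong (rotate K q) eq) (rotate-rotate p+q≡K y∈))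

  ∑-PPF-rotation-invariant : ∀ {K} → 1 ≤ K → (h : List ℕ → ℕ) →
    (∀ {p w} → p < K → w ∈ words (suc K) K → h (map (rotate K p) w) ≡ h w) →
    K * ∑[ w ← words (suc K) K ] (𝟙 (does (isPPF? (suc K) w)) * h w) ≡ ∑ (words (suc K) K) h
  ∑-PPF-rotation-invariant {K} 1≤K h h-invariant = sym (begin
      ∑ W h
    ≡⟨ ∑-cong W (λ w∈ → sym (trans (cong (_* h _) (exactly-one-rotation-PPF 1≤K w∈)) (+-identityʳ _))) ⟩
      ∑[ w ← W ] (∑[ p ← upTo K ] ppf (map (rotate K p) w) * h w)
    ≡⟨ ∑-congʳ W (λ w → sym (∑-*ʳ (upTo K) _ (h w))) ⟩
      ∑[ w ← W ] ∑[ p ← upTo K ] (ppf (map (rotate K p) w) * h w)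
    ≡⟨ ∑-comm W (upTo K) (λ w p → ppf (map (rotate K p) w) * h w) ⟩
      ∑[ p ← upTo K ] ∑[ w ← W ] (ppf (map (rotate K p) w) * h w)
    ≡⟨ ∑-cong (upTo K) (λ {p} p∈ → ∑-cong W (λ {w} w∈ →
         cong (ppf (map (rotate K p) w) *_) (sym (h-invariant (∈-upTo⁻ p∈) w∈)))) ⟩
      ∑[ p ← upTo K ] ∑[ w ← W ] (ppf (map (rotate K p) w) * h (map (rotate K p) w))
    ≡⟨ ∑-cong (upTo K) (λ p∈ → ∑-words-rotate (∈-upTo⁻ p∈) (suc K) (λ w → ppf w * h w)) ⟩
      ∑[ _ ← upTo K ] ∑[ w ← W ] (ppf w * h w)
    ≡⟨ ∑-const (upTo K) _ ⟩
      length (upTo K) * ∑[ w ← W ] (ppf w * h w)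
    ≡⟨ cong (_* ∑[ w ← W ] (ppf w * h w)) (length-upTo K) ⟩
      K * ∑[ w ← W ] (ppf w * h w) ∎)
    where
    open ≡-Reasoning
    W = words (suc K) K
    ppf : List ℕ → ℕ
    ppf w = 𝟙 (does (isPPF? (suc K) w))

  -- The quasisymmetric side

  FCoeff≡∑ : ∀ n S m α → FCoeff n S m α ≡ ∑[ b ← words n m ] (𝟙 (fOK S 1 b) * 𝟙 (hasContent m α b))
  FCoeff≡∑ n S m α = trans (length-filter≡∑ _ (words n m)) (∑-congʳ (words n m) (λ b → 𝟙-∧ (fOK S 1 b) _))

  FCoeff-cong : ∀ n {S S′} m α → (∀ i → S i ≡ S′ i) → FCoeff n S m α ≡ FCoeff n S′ m α
  FCoeff-cong n {S} {S′} m α S≗S′ = trans (FCoeff≡∑ n S m α)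
    (trans (∑-congʳ (words n m) (λ b → cong (λ c → 𝟙 c * _) (fOK-cong S≗S′ 1 b))) (sym (FCoeff≡∑ n S′ m α)))

  hookCoeff≡∑ : ∀ n i m α → hookCoeff n i m α ≡
    ∑[ r ← words i m ] ∑[ c ← words (n ∸ i) m ] 𝟙 (isHookSSYT r c ∧ hasContent m α (r ++ c))
  hookCoeff≡∑ n i m α = trans (length-filter≡∑ (T? ∘ isHookPair) (concatMap (λ r → map (r ,_) C) R))
    (trans (cong (λ rcs → ∑[ rc ← rcs ] 𝟙 (isHookPair rc)) (concatMap≡cartesianProductWith _,_ R C))
           (∑-cartesianProductWith _,_ R C (𝟙 ∘ isHookPair)))
    where
    R = words i m
    C = words (n ∸ i) m
    isHookPair : List ℕ × List ℕ → Bool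
    isHookPair (r , c) = isHookSSYT r c ∧ hasContent m α (r ++ c)

  ∑-PPF≡∑-words : ∀ K → 1 ≤ K → (L : List (List ℕ)) → Unique L → (∀ π → (π ∈ L) ⇔ IsPPF (suc K) π) →
    (h : List ℕ → ℕ) → ∑ L h ≡ ∑[ w ← words (suc K) K ] (𝟙 (does (isPPF? (suc K) w)) * h w)
  ∑-PPF≡∑-words K 1≤K L L! L⇔PPF h = trans
    (∑-unique-bag L! (filter⁺ (isPPF? (suc K)) (words-unique (suc K) K)) (λ π → mk⇔ (to π) (from π)) h)
    (∑-filter (isPPF? (suc K)) (words (suc K) K) h)
    where
    to : ∀ π → π ∈ L → π ∈ filter (isPPF? (suc K)) (words (suc K) K)
    to π π∈ = let ppf = Equivalence.to (L⇔PPF π) π∈ in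
      ∈-filter⁺ (isPPF? (suc K)) (proj₁ (Equivalence.to (IsPPF⇔PrimeCounts K π 1≤K) ppf)) ppf
    from : ∀ π → π ∈ filter (isPPF? (suc K)) (words (suc K) K) → π ∈ L
    from π π∈ = Equivalence.from (L⇔PPF π) (proj₂ (∈-filter⁻ (isPPF? (suc K)) {xs = words (suc K) K} π∈))

  K*∑-PPF-FCoeff : ∀ K → 1 ≤ K → (L : List (List ℕ)) → Unique L → (∀ π → (π ∈ L) ⇔ IsPPF (suc K) π) →
                   ∀ m α →
    K * ∑[ π ← L ] FCoeff (suc K) (Tie π) m α ≡ ∑[ b ← words (suc K) m ] (weight K b * 𝟙 (hasContent m α b))
  K*∑-PPF-FCoeff K 1≤K L L! L⇔PPF m α = begin
      K * ∑[ π ← L ] FCoeff n (Tie π) m α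
    ≡⟨ cong (K *_) (∑-PPF≡∑-words K 1≤K L L! L⇔PPF _) ⟩
      K * ∑[ w ← W ] (𝟙 (does (isPPF? n w)) * FCoeff n (Tie w) m α)
    ≡⟨ ∑-PPF-rotation-invariant 1≤K _ (λ p<K w∈ → FCoeff-cong n m α (Tie-rotate p<K (letters-words n K w∈))) ⟩
      ∑[ w ← W ] FCoeff n (Tie w) m α
    ≡⟨ ∑-congʳ W (λ w → FCoeff≡∑ n (Tie w) m α) ⟩
      ∑[ w ← W ] ∑[ b ← B ] (𝟙 (fOK (Tie w) 1 b) * 𝟙 (hasContent m α b))
    ≡⟨ ∑-comm W B _ ⟩
      ∑[ b ← B ] ∑[ w ← W ] (𝟙 (fOK (Tie w) 1 b) * 𝟙 (hasContent m α b))
    ≡⟨ ∑-cong B (λ {b} b∈ → trans (∑-*ʳ W (λ w → 𝟙 (fOK (Tie w) 1 b)) _)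
         (cong (_* _) (∑-compatible≡weight n K b 1≤K (length-words n m b∈)))) ⟩
      ∑[ b ← B ] (weight K b * 𝟙 (hasContent m α b)) ∎
    where
    open ≡-Reasoning
    n = suc K
    W = words n K
    B = words n m

  FCoeff-1≡hookCoeff : ∀ S m α → FCoeff 1 S m α ≡ hookCoeff 1 1 m α
  FCoeff-1≡hookCoeff S m α = trans (FCoeff≡∑ 1 S m α) (trans (∑-cong (words 1 m) single-letter) (sym (hookCoeff≡∑ 1 1 m α)))
    where
    single-letter : ∀ {b} → b ∈ words 1 m → 𝟙 (fOK S 1 b) * 𝟙 (hasContent m α b) ≡
                    ∑[ c ← words 0 m ] 𝟙 (isHookSSYT b c ∧ hasContent m α (b ++ c))
    single-letter {b} b∈ with b | length-words 1 m b∈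
    ... | v ∷ [] | _ = refl

  -- Sorted words and hook tableaux

  StrictlySorted : List ℕ → Set
  StrictlySorted = AllPairs _<_

  fOK-const⇔Linked : ∀ b {R : ℕ → ℕ → Set} → (∀ {x y} → T (if b then x <ᵇ y else x ≤ᵇ y) ⇔ R x y) →
                     ∀ i l → T (fOK (λ _ → b) i l) ⇔ Linked R l
  fOK-const⇔Linked b {R} step i l = mk⇔ (to i l) (from i l)
    where
    to : ∀ i l → T (fOK (λ _ → b) i l) → Linked R l
    to i []          _ = []
    to i (x ∷ [])    _ = [-]
    to i (x ∷ y ∷ l) t = let xRy , t′ = Equivalence.to T-∧ t in Equivalence.to step xRy ∷ to (suc i) (y ∷ l) t′
    from : ∀ i l → Linked R l → T (fOK (λ _ → b) i l)
    from i []          _           = _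
    from i (x ∷ [])    _           = _
    from i (x ∷ y ∷ l) (xRy ∷ ryl) = Equivalence.from T-∧ (Equivalence.from step xRy , from (suc i) (y ∷ l) ryl)

  weakInc⇔Sorted : ∀ l → T (weakInc l) ⇔ Sorted l
  weakInc⇔Sorted l = mk⇔ (Linked⇒AllPairs ≤-trans ∘ Equivalence.to linked) (Equivalence.from linked ∘ AllPairs⇒Linked)
    where linked = fOK-const⇔Linked false (mk⇔ (≤ᵇ⇒≤ _ _) ≤⇒≤ᵇ) 1 l

  strictInc⇔StrictlySorted : ∀ l → T (strictInc l) ⇔ StrictlySorted l
  strictInc⇔StrictlySorted l = mk⇔ (Linked⇒AllPairs <-trans ∘ Equivalence.to linked) (Equivalence.from linked ∘ AllPairs⇒Linked)
    where linked = fOK-const⇔Linked true (mk⇔ (<ᵇ⇒< _ _) <⇒<ᵇ) 1 l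

  -- on a sorted word: its distinct values other than the smallest
  ascentTops : List ℕ → List ℕ
  ascentTops (x ∷ y ∷ l) = if x <ᵇ y then y ∷ ascentTops (y ∷ l) else ascentTops (y ∷ l)
  ascentTops _           = []

  ascentTops-< : ∀ {x y} l → x < y → ascentTops (x ∷ y ∷ l) ≡ y ∷ ascentTops (y ∷ l)
  ascentTops-< {x} {y} l x<y rewrite dec-true (x <? y) x<y = refl

  ascentTops-≡ : ∀ x l → ascentTops (x ∷ x ∷ l) ≡ ascentTops (x ∷ l)
  ascentTops-≡ x l rewrite dec-false (x <? x) (<-irrefl refl) = refl

  length-ascentTops : ∀ x l → length (ascentTops (x ∷ l)) ≤ length l
  length-ascentTops x []      = z≤n
  length-ascentTops x (y ∷ l) with x <ᵇ y
  ... | true  = s≤s (length-ascentTops y l)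
  ... | false = m≤n⇒m≤1+n (length-ascentTops y l)

  ascentTops-above : ∀ {y l} → Sorted (y ∷ l) → All (y <_) (ascentTops (y ∷ l))
  ascentTops-above {y} {[]}     _                  = []
  ascentTops-above {y} {y′ ∷ l} ((y≤y′ ∷ _) ∷ l↑) with m≤n⇒m<n∨m≡n y≤y′
  ... | inj₁ y<y′ rewrite ascentTops-< l y<y′ = y<y′ ∷ All.map (<-trans y<y′) (ascentTops-above l↑)
  ... | inj₂ refl rewrite ascentTops-≡ y l    = ascentTops-above l↑

  ascentTops-sorted : ∀ {l} → Sorted l → StrictlySorted (ascentTops l)
  ascentTops-sorted {[]}         _                 = []
  ascentTops-sorted {x ∷ []}     _                 = []
  ascentTops-sorted {x ∷ y ∷ l} ((x≤y ∷ _) ∷ l↑) with m≤n⇒m<n∨m≡n x≤y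
  ... | inj₁ x<y rewrite ascentTops-< l x<y = ascentTops-above l↑ ∷ ascentTops-sorted l↑
  ... | inj₂ refl rewrite ascentTops-≡ x l  = ascentTops-sorted l↑

  ascentTops-⊆ : ∀ {l v} → Sorted l → v ∈ ascentTops l → v ∈ l
  ascentTops-⊆ {x ∷ y ∷ l} ((x≤y ∷ _) ∷ l↑) v∈ with m≤n⇒m<n∨m≡n x≤y
  ... | inj₁ x<y rewrite ascentTops-< l x<y with v∈
  ...   | here refl = there (here refl)
  ...   | there v∈′ = there (ascentTops-⊆ l↑ v∈′)
  ascentTops-⊆ {x ∷ y ∷ l} ((x≤y ∷ _) ∷ l↑) v∈ | inj₂ refl rewrite ascentTops-≡ x l = there (ascentTops-⊆ l↑ v∈)

  ascentTops-complete : ∀ {z l v} → Sorted (z ∷ l) → v ∈ z ∷ l → z < v → v ∈ ascentTops (z ∷ l)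
  ascentTops-complete _ (here refl) z<v = contradiction z<v (<-irrefl refl)
  ascentTops-complete {z} {y ∷ l} ((z≤y ∷ _) ∷ l↑) (there v∈) z<v with m≤n⇒m<n∨m≡n z≤y
  ... | inj₂ refl rewrite ascentTops-≡ z l = ascentTops-complete l↑ v∈ z<v
  ... | inj₁ z<y rewrite ascentTops-< l z<y with v∈
  ...   | here refl   = here refl
  ...   | there v∈l with l↑
  ...     | y≤l ∷ _ with m≤n⇒m<n∨m≡n (All.lookup y≤l v∈l)
  ...       | inj₁ y<v  = there (ascentTops-complete l↑ (there v∈l) y<v)
  ...       | inj₂ refl = here refl

  sublists : List ℕ → List (List ℕ)
  sublists []      = [ [] ]
  sublists (d ∷ D) = map (d ∷_) (sublists D) ++ sublists D

  length-sublists : ∀ D {c} → c ∈ sublists D → length c ≤ length D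
  length-sublists []      (here refl) = z≤n
  length-sublists (d ∷ D) c∈ with ∈-++⁻ (map (d ∷_) (sublists D)) c∈
  ... | inj₂ c∈′ = m≤n⇒m≤1+n (length-sublists D c∈′)
  ... | inj₁ c∈′ with ∈-map⁻ (d ∷_) c∈′
  ...   | c , c∈ , refl = s≤s (length-sublists D c∈)

  []∈sublists : ∀ D → [] ∈ sublists D
  []∈sublists []      = here refl
  []∈sublists (d ∷ D) = ∈-++⁺ʳ (map (d ∷_) (sublists D)) ([]∈sublists D)

  sublists-⊆ : ∀ D {c} → c ∈ sublists D → All (_∈ D) c
  sublists-⊆ []      (here refl) = []
  sublists-⊆ (d ∷ D) c∈ with ∈-++⁻ (map (d ∷_) (sublists D)) c∈
  ... | inj₂ c∈′ = All.map there (sublists-⊆ D c∈′)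
  ... | inj₁ c∈′ with ∈-map⁻ (d ∷_) c∈′
  ...   | c , c∈ , refl = here refl ∷ All.map there (sublists-⊆ D c∈)

  sublists-sorted : ∀ D {c} → StrictlySorted D → c ∈ sublists D → StrictlySorted c
  sublists-sorted []      _             (here refl) = []
  sublists-sorted (d ∷ D) (d<D ∷ D↑) c∈ with ∈-++⁻ (map (d ∷_) (sublists D)) c∈
  ... | inj₂ c∈′ = sublists-sorted D D↑ c∈′
  ... | inj₁ c∈′ with ∈-map⁻ (d ∷_) c∈′
  ...   | c , c∈ , refl = All.map (All.lookup d<D) (sublists-⊆ D c∈) ∷ sublists-sorted D D↑ c∈

  ∈-sublists : ∀ D {c} → StrictlySorted D → StrictlySorted c → All (_∈ D) c → c ∈ sublists D
  ∈-sublists D       _          []            _                 = []∈sublists D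
  ∈-sublists (d ∷ D) (d<D ∷ D↑) (v<c ∷ c↑)    (here refl ∷ c⊆) =
    ∈-++⁺ˡ (∈-map⁺ (d ∷_) (∈-sublists D D↑ c↑ (All.zipWith (λ (v<u , u∈) → drop-head v<u u∈) (v<c , c⊆))))
    where
    drop-head : ∀ {u} → d < u → u ∈ d ∷ D → u ∈ D
    drop-head d<u (here refl) = contradiction d<u (<-irrefl refl)
    drop-head d<u (there u∈)  = u∈
  ∈-sublists (d ∷ D) {v ∷ c} (d<D ∷ D↑) (v<c ∷ c↑) (there v∈ ∷ c⊆) =
    ∈-++⁺ʳ (map (d ∷_) (sublists D)) (∈-sublists D D↑ (v<c ∷ c↑) (v∈ ∷ All.zipWith (λ (v<u , u∈) → drop-head v<u u∈) (v<c , c⊆)))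
    where
    drop-head : ∀ {u} → v < u → u ∈ d ∷ D → u ∈ D
    drop-head v<u (here refl) = contradiction (All.lookup d<D v∈) (<-asym v<u)
    drop-head v<u (there u∈)  = u∈

  sublists-unique : ∀ D → StrictlySorted D → Unique (sublists D)
  sublists-unique []      _          = [] ∷ []
  sublists-unique (d ∷ D) (d<D ∷ D↑) = ++⁺ (map⁺ ∷-injectiveʳ (sublists-unique D D↑)) (sublists-unique D D↑) disjoint
    where
    disjoint : ∀ {c} → c ∈ map (d ∷_) (sublists D) × c ∈ sublists D → ⊥
    disjoint (c∈₁ , c∈₂) with ∈-map⁻ (d ∷_) c∈₁
    ... | c , _ , refl with sublists-⊆ D c∈₂
    ...   | d∈D ∷ _ = <-irrefl refl (All.lookup d<D d∈D)

  -- equals x^(N − |D|) (1 + x)^|D|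
  sublistPolynomial : ℕ → ℕ → List ℕ → ℕ
  sublistPolynomial x N D = ∑[ c ← sublists D ] (x ^ (N ∸ length c))

  sublistPolynomial-suc : ∀ x N D → length D ≤ N → sublistPolynomial x (suc N) D ≡ x * sublistPolynomial x N D
  sublistPolynomial-suc x N D D≤N = trans
    (∑-cong (sublists D) (λ c∈ → cong (x ^_) (+-∸-assoc 1 (≤-trans (length-sublists D c∈) D≤N))))
    (∑-*ˡ x (sublists D) _)

  sublistPolynomial-∷ : ∀ x N d D → length D ≤ N →
    sublistPolynomial x (suc N) (d ∷ D) ≡ suc x * sublistPolynomial x N D
  sublistPolynomial-∷ x N d D D≤N = begin
      ∑[ c ← map (d ∷_) (sublists D) ++ sublists D ] (x ^ (suc N ∸ length c))
    ≡⟨ ∑-++ (map (d ∷_) (sublists D)) (sublists D) _ ⟩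
      ∑[ c ← map (d ∷_) (sublists D) ] (x ^ (suc N ∸ length c)) + ∑[ c ← sublists D ] (x ^ (suc N ∸ length c))
    ≡⟨ cong₂ _+_ (∑-map (d ∷_) (sublists D) _) (sublistPolynomial-suc x N D D≤N) ⟩
      sublistPolynomial x N D + x * sublistPolynomial x N D ∎
    where open ≡-Reasoning

  ∑-pick-power : ∀ x N ℓ → ℓ ≤ N → ∑[ i ← vals (suc N) ] (x ^ (i ∸ 1) * 𝟙 (ℓ ≡ᵇ suc N ∸ i)) ≡ x ^ (N ∸ ℓ)
  ∑-pick-power x N ℓ ℓ≤N = begin
      ∑[ i ← vals (suc N) ] (x ^ (i ∸ 1) * 𝟙 (ℓ ≡ᵇ suc N ∸ i))
    ≡⟨ ∑-single (vals (suc N)) _ (vals-unique (suc N)) (∈-vals⁺ (s≤s z≤n , s≤s (m∸n≤m N ℓ))) others ⟩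
      x ^ (N ∸ ℓ) * 𝟙 (ℓ ≡ᵇ N ∸ (N ∸ ℓ))
    ≡⟨ cong (λ b → x ^ (N ∸ ℓ) * 𝟙 b) (dec-true (ℓ ≟ _) (sym (m∸[m∸n]≡n ℓ≤N))) ⟩
      x ^ (N ∸ ℓ) * 1
    ≡⟨ *-identityʳ _ ⟩
      x ^ (N ∸ ℓ) ∎
    where
    open ≡-Reasoning
    others : ∀ {i} → i ∈ vals (suc N) → i ≢ suc (N ∸ ℓ) → x ^ (i ∸ 1) * 𝟙 (ℓ ≡ᵇ suc N ∸ i) ≡ 0
    others {i} i∈ i≢ = trans (cong (λ b → x ^ (i ∸ 1) * 𝟙 b) (dec-false (ℓ ≟ suc N ∸ i) λ ℓ≡ → i≢ (begin
        i                     ≡⟨ sym (m∸[m∸n]≡n (proj₂ (∈-vals⁻ i∈))) ⟩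
        suc N ∸ (suc N ∸ i)   ≡⟨ cong (suc N ∸_) (sym ℓ≡) ⟩
        suc N ∸ ℓ             ≡⟨ +-∸-assoc 1 ℓ≤N ⟩
        suc (N ∸ ℓ)           ∎)))
      (*-zeroʳ (x ^ (i ∸ 1)))

  ∑-powers : ∀ x N D → length D ≤ N →
    ∑[ i ← vals (suc N) ] (x ^ (i ∸ 1) * ∑[ c ← sublists D ] 𝟙 (length c ≡ᵇ suc N ∸ i)) ≡ sublistPolynomial x N D
  ∑-powers x N D D≤N = begin
      ∑[ i ← vals (suc N) ] (x ^ (i ∸ 1) * ∑[ c ← sublists D ] 𝟙 (length c ≡ᵇ suc N ∸ i))
    ≡⟨ ∑-congʳ (vals (suc N)) (λ i → sym (∑-*ˡ (x ^ (i ∸ 1)) (sublists D) _)) ⟩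
      ∑[ i ← vals (suc N) ] ∑[ c ← sublists D ] (x ^ (i ∸ 1) * 𝟙 (length c ≡ᵇ suc N ∸ i))
    ≡⟨ ∑-comm (vals (suc N)) (sublists D) _ ⟩
      ∑[ c ← sublists D ] ∑[ i ← vals (suc N) ] (x ^ (i ∸ 1) * 𝟙 (length c ≡ᵇ suc N ∸ i))
    ≡⟨ ∑-cong (sublists D) (λ {c} c∈ → ∑-pick-power x N (length c) (≤-trans (length-sublists D c∈) D≤N)) ⟩
      sublistPolynomial x N D ∎
    where open ≡-Reasoning

  Sorted-∷ : ∀ {x y l} → x ≤ y → Sorted (y ∷ l) → Sorted (x ∷ y ∷ l)
  Sorted-∷ x≤y sorted@(y≤l ∷ _) = (x≤y ∷ All.map (≤-trans x≤y) y≤l) ∷ sorted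

  weight-∷∷≡0 : ∀ K x y l → (x ≤ y → weight K (y ∷ l) ≡ 0) → weight K (x ∷ y ∷ l) ≡ 0
  weight-∷∷≡0 K x y l tail≡0 with x ≤? y
  ... | yes x≤y = trans (cong (stepWeight K x y *_) (tail≡0 x≤y)) (*-zeroʳ (stepWeight K x y))
  ... | no  x≰y rewrite dec-false (x <? y) (x≰y ∘ <⇒≤) | dec-false (x ≟ y) (x≰y ∘ ≤-reflexive) = refl

  weight-unsorted : ∀ K b → ¬ Sorted b → weight K b ≡ 0
  weight-unsorted K []          unsorted = contradiction [] unsorted
  weight-unsorted K (x ∷ [])    unsorted = contradiction ([] ∷ []) unsorted
  weight-unsorted K (x ∷ y ∷ l) unsorted =
    weight-∷∷≡0 K x y l (λ x≤y → weight-unsorted K (y ∷ l) (unsorted ∘ Sorted-∷ x≤y))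

  weight-sorted : ∀ x z l → Sorted (z ∷ l) →
    weight (suc x) (z ∷ l) ≡ suc x * sublistPolynomial x (length l) (ascentTops (z ∷ l))
  weight-sorted x z []      _ = sym (*-identityʳ (suc x))
  weight-sorted x z (y ∷ l) ((z≤y ∷ _) ∷ sorted) with <-cmp z y
  ... | tri< z<y _ _ rewrite dec-true (z <? y) z<y =
    cong (suc x *_) (trans (weight-sorted x y l sorted)
      (sym (sublistPolynomial-∷ x (length l) y (ascentTops (y ∷ l)) (length-ascentTops y l))))
  ... | tri≈ z≮z refl _ rewrite dec-false (z <? z) z≮z | dec-true (z ≟ z) refl = begin
      x * weight (suc x) (z ∷ l)
    ≡⟨ cong (x *_) (weight-sorted x z l sorted) ⟩
      x * (suc x * P)
    ≡⟨ *-exchange x (suc x) P ⟩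
      suc x * (x * P)
    ≡⟨ cong (suc x *_) (sym (sublistPolynomial-suc x (length l) (ascentTops (z ∷ l)) (length-ascentTops z l))) ⟩
      suc x * sublistPolynomial x (suc (length l)) (ascentTops (z ∷ l)) ∎
    where
    open ≡-Reasoning
    P = sublistPolynomial x (length l) (ascentTops (z ∷ l))
  ... | tri> _ _ y<z = contradiction z≤y (<⇒≱ y<z)

  count-↭ : ∀ v {xs ys} → xs ↭ ys → count v xs ≡ count v ys
  count-↭ v xs↭ys = ↭-length (filter-↭ (T? ∘ (_≡ᵇ v)) xs↭ys)

  count-++ : ∀ v xs ys → count v (xs ++ ys) ≡ count v xs + count v ys
  count-++ v xs ys = trans (cong length (filter-++ (T? ∘ (_≡ᵇ v)) xs ys)) (length-++ (filter (T? ∘ (_≡ᵇ v)) xs))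

  count-∉ : ∀ {v xs} → v ∉ xs → count v xs ≡ 0
  count-∉ {v} v∉xs = cong length (filter-none (T? ∘ (_≡ᵇ v)) (All.tabulate λ {x} x∈ x≡v → v∉xs (subst (_∈ _) (≡ᵇ⇒≡ x v x≡v) x∈)))

  count-∷ : ∀ v xs → count v (v ∷ xs) ≡ suc (count v xs)
  count-∷ v xs = cong length (filter-accept (T? ∘ (_≡ᵇ v)) {v} {xs} (≡⇒≡ᵇ v v refl))

  ∈⇒count-pos : ∀ {v xs} → v ∈ xs → 1 ≤ count v xs
  ∈⇒count-pos {v} v∈ = filter-some (T? ∘ (_≡ᵇ v)) (Any.map (λ { refl → ≡⇒≡ᵇ v v refl }) v∈)

  count-pos⇒∈ : ∀ {v} xs → 1 ≤ count v xs → v ∈ xs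
  count-pos⇒∈ {v} xs pos with filter-nonempty (T? ∘ (_≡ᵇ v)) xs pos
  ... | x , x∈ , x≡v = subst (_∈ xs) (≡ᵇ⇒≡ x v x≡v) x∈

  allᵇ-cong : {A : Set} {p q : A → Bool} → (∀ x → p x ≡ q x) → ∀ xs → allᵇ p xs ≡ allᵇ q xs
  allᵇ-cong p≗q []       = refl
  allᵇ-cong p≗q (x ∷ xs) = cong₂ _∧_ (p≗q x) (allᵇ-cong p≗q xs)

  hasContent-cong : ∀ m α w w′ → (∀ v → count v w ≡ count v w′) → hasContent m α w ≡ hasContent m α w′
  hasContent-cong m α w w′ same = allᵇ-cong (λ k → cong (_≡ᵇ α k) (same (suc (toℕ k)))) (allFin m)

  hasContent⇒count : ∀ m α w → T (hasContent m α w) → ∀ k → count (suc (toℕ k)) w ≡ α k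
  hasContent⇒count m α w content k = ≡ᵇ⇒≡ _ _ (All.lookup (Equivalence.to (allᵇ⇔All _ (allFin m)) content) (∈-allFin k))

  non-letter-∉ : ∀ {m v w} → All (Letter m) w → ¬ Letter m v → v ∉ w
  non-letter-∉ letters ¬letter v∈ = ¬letter (All.lookup letters v∈)

  same-content : ∀ m α {w w′} → All (Letter m) w → All (Letter m) w′ →
                 T (hasContent m α w) → T (hasContent m α w′) → ∀ v → count v w ≡ count v w′
  same-content m α w-letters w′-letters _ _ zero = trans (count-∉ (non-letter-∉ w-letters λ ())) (sym (count-∉ (non-letter-∉ w′-letters λ ())))
  same-content m α {w} {w′} w-letters w′-letters content content′ (suc u) with u <? m
  ... | yes u<m = begin
      count (suc u) w                      ≡⟨ cong (λ v → count (suc v) w) (sym (toℕ-fromℕ< u<m)) ⟩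
      count (suc (toℕ (fromℕ< u<m))) w     ≡⟨ hasContent⇒count m α w content (fromℕ< u<m) ⟩
      α (fromℕ< u<m)                       ≡⟨ sym (hasContent⇒count m α w′ content′ (fromℕ< u<m)) ⟩
      count (suc (toℕ (fromℕ< u<m))) w′    ≡⟨ cong (λ v → count (suc v) w′) (toℕ-fromℕ< u<m) ⟩
      count (suc u) w′                     ∎
    where open ≡-Reasoning
  ... | no  u≮m = trans (count-∉ (non-letter-∉ w-letters (u≮m ∘ proj₂))) (sym (count-∉ (non-letter-∉ w′-letters (u≮m ∘ proj₂))))

  below-head-∉ : ∀ {x y l} → x < y → Sorted (y ∷ l) → x ∉ y ∷ l
  below-head-∉ x<y _               (here refl) = <-irrefl refl x<y
  below-head-∉ x<y (y≤l ∷ _) (there x∈) = <⇒≱ x<y (All.lookup y≤l x∈)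

  sorted-unique : ∀ {a b} → Sorted a → Sorted b → (∀ v → count v a ≡ count v b) → a ≡ b
  sorted-unique {[]}    {[]}    _ _ _ = refl
  sorted-unique {[]}    {y ∷ b} _ _ same = contradiction (trans (same y) (count-∷ y b)) (λ ())
  sorted-unique {x ∷ a} {[]}    _ _ same = contradiction (trans (sym (same x)) (count-∷ x a)) (λ ())
  sorted-unique {x ∷ a} {y ∷ b} a↑@(_ ∷ a↑′) b↑@(_ ∷ b↑′) same with <-cmp x y
  ... | tri< x<y _ _ = contradiction (trans (sym (count-∷ x a)) (trans (same x) (count-∉ (below-head-∉ x<y b↑)))) (λ ())
  ... | tri> _ _ y<x = contradiction (trans (sym (count-∷ y b)) (trans (sym (same y)) (count-∉ (below-head-∉ y<x a↑)))) (λ ())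
  ... | tri≈ _ refl _ = cong (x ∷_) (sorted-unique a↑′ b↑′ λ v →
    +-cancelˡ-≡ (count v (x ∷ [])) _ _ (trans (sym (count-++ v (x ∷ []) a)) (trans (same v) (count-++ v (x ∷ []) b))))

  delete : ℕ → List ℕ → List ℕ
  delete v []       = []
  delete v (x ∷ xs) = if x ≡ᵇ v then xs else x ∷ delete v xs

  delete-↭ : ∀ {v l} → v ∈ l → l ↭ v ∷ delete v l
  delete-↭ {v} {x ∷ xs} v∈ with x ≡ᵇ v in x≡ᵇv
  ... | true rewrite ≡ᵇ⇒≡ x v (subst T (sym x≡ᵇv) _) = ↭-refl
  ... | false with v∈
  ...   | here refl = contradiction (≡⇒≡ᵇ x x refl) (subst T x≡ᵇv)
  ...   | there v∈xs = ↭-trans (prep x (delete-↭ v∈xs)) (swap x v ↭-refl)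

  delete-All : ∀ {P : ℕ → Set} v {l} → All P l → All P (delete v l)
  delete-All v {[]}     []         = []
  delete-All v {x ∷ xs} (px ∷ pxs) with x ≡ᵇ v
  ... | true  = pxs
  ... | false = px ∷ delete-All v pxs

  delete-sorted : ∀ v {l} → Sorted l → Sorted (delete v l)
  delete-sorted v {[]}     []           = []
  delete-sorted v {x ∷ xs} (x≤xs ∷ xs↑) with x ≡ᵇ v
  ... | true  = xs↑
  ... | false = delete-All v x≤xs ∷ delete-sorted v xs↑

  deleteAll : List ℕ → List ℕ → List ℕ
  deleteAll []      b = b
  deleteAll (v ∷ c) b = delete v (deleteAll c b)

  deleteAll-sorted : ∀ c {b} → Sorted b → Sorted (deleteAll c b)
  deleteAll-sorted []      b↑ = b↑
  deleteAll-sorted (v ∷ c) b↑ = delete-sorted v (deleteAll-sorted c b↑)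

  deleteAll-head : ∀ {z} c b → All (z <_) c → deleteAll c (z ∷ b) ≡ z ∷ deleteAll c b
  deleteAll-head {z} []      b _           = refl
  deleteAll-head {z} (v ∷ c) b (z<v ∷ z<c) rewrite deleteAll-head c b z<c | dec-false (z ≟ v) (<⇒≢ z<v) = refl

  deleteAll-↭ : ∀ c b → StrictlySorted c → All (_∈ b) c → b ↭ c ++ deleteAll c b
  deleteAll-↭ []      b _            _           = ↭-refl
  deleteAll-↭ (v ∷ c) b (v<c ∷ c↑) (v∈b ∷ c⊆b) =
    ↭-trans b↭ (↭-trans (++⁺ˡ c (delete-↭ v∈rest)) (shift v c (delete v (deleteAll c b))))
    where
    b↭ = deleteAll-↭ c b c↑ c⊆b
    v∈rest : v ∈ deleteAll c b
    v∈rest = count-pos⇒∈ (deleteAll c b) (≤-trans (∈⇒count-pos v∈b) (≤-reflexive (begin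
      count v b                                ≡⟨ count-↭ v b↭ ⟩
      count v (c ++ deleteAll c b)             ≡⟨ count-++ v c (deleteAll c b) ⟩
      count v c + count v (deleteAll c b)      ≡⟨ cong (_+ count v (deleteAll c b)) (count-∉ (λ v∈c → <-irrefl refl (All.lookup v<c v∈c))) ⟩
      count v (deleteAll c b)                  ∎)))
      where open ≡-Reasoning

  module _ (m : ℕ) (α : Fin m → ℕ) where

    isHook : List ℕ → List ℕ → Bool
    isHook r c = isHookSSYT r c ∧ hasContent m α (r ++ c)

    isHook⇔ : ∀ r c → T (isHook r c) ⇔ (Sorted r × StrictlySorted c × T (headLt r c) × T (hasContent m α (r ++ c)))
    isHook⇔ r c = mk⇔
      (λ h → let shape , content = Equivalence.to T-∧ h
                 weak , rest     = Equivalence.to T-∧ shape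
                 strict , head   = Equivalence.to T-∧ rest
             in Equivalence.to (weakInc⇔Sorted r) weak , Equivalence.to (strictInc⇔StrictlySorted c) strict , head , content)
      (λ (r↑ , c↑ , head , content) → Equivalence.from T-∧ (Equivalence.from T-∧
        (Equivalence.from (weakInc⇔Sorted r) r↑ , Equivalence.from T-∧ (Equivalence.from (strictInc⇔StrictlySorted c) c↑ , head)) , content))

    hook-row-unique : ∀ {r r′ c} → All (Letter m) r → All (Letter m) r′ → All (Letter m) c →
                      T (isHook r c) → T (isHook r′ c) → r ≡ r′
    hook-row-unique {r} {r′} {c} r-letters r′-letters c-letters hook hook′
      with Equivalence.to (isHook⇔ r c) hook | Equivalence.to (isHook⇔ r′ c) hook′
    ... | r↑ , _ , _ , content | r′↑ , _ , _ , content′ = sorted-unique r↑ r′↑ λ v → +-cancelʳ-≡ (count v c) _ _ (begin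
      count v r + count v c      ≡⟨ sym (count-++ v r c) ⟩
      count v (r ++ c)           ≡⟨ same-content m α (All.++⁺ r-letters c-letters) (All.++⁺ r′-letters c-letters) content content′ v ⟩
      count v (r′ ++ c)          ≡⟨ count-++ v r′ c ⟩
      count v r′ + count v c     ∎)
      where open ≡-Reasoning

    -- A hook tableau (r, c) of content α is determined by its column c, a sublist of ascentTops b,
    -- with r = b minus c.
    module HookExpansion (n : ℕ) {z : ℕ} {b′ : List ℕ} (b∈ : z ∷ b′ ∈ words n m)
                         (b↑ : Sorted (z ∷ b′)) (b-content : T (hasContent m α (z ∷ b′))) where

      open import Data.List.Membership.DecPropositional (≡-dec _≟_) using (_∈?_)

      private
        b = z ∷ b′
        D = ascentTops b
        D↑ = ascentTops-sorted b↑
        z<D = ascentTops-above b↑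
        b-letters = letters-words n m b∈

      deleted-row : ∀ {i c} → i ≤ n → c ∈ sublists D → length c ≡ n ∸ i →
                    deleteAll c b ∈ words i m × T (isHook (deleteAll c b) c)
      deleted-row {i} {c} i≤n c∈ length-c = ∈-words⁺ length-r₀ (proj₂ (All.++⁻ c c++r₀-letters)) , hook₀
        where
        c⊆D = sublists-⊆ D c∈
        c↑ = sublists-sorted D D↑ c∈
        r₀ = deleteAll c b
        b↭ : b ↭ c ++ r₀
        b↭ = deleteAll-↭ c b c↑ (All.map (ascentTops-⊆ b↑) c⊆D)
        c++r₀-letters = All-resp-↭ b↭ b-letters
        length-r₀ : length r₀ ≡ i
        length-r₀ = +-cancelˡ-≡ (n ∸ i) _ _ (begin
          n ∸ i + length r₀      ≡⟨ cong (_+ length r₀) (sym length-c) ⟩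
          length c + length r₀   ≡⟨ sym (length-++ c) ⟩
          length (c ++ r₀)       ≡⟨ sym (↭-length b↭) ⟩
          length b               ≡⟨ length-words n m b∈ ⟩
          n                      ≡⟨ sym (m∸n+n≡m i≤n) ⟩
          n ∸ i + i              ∎)
          where open ≡-Reasoning
        head₀ : ∀ {c} → All (z <_) c → T (headLt (z ∷ deleteAll c b′) c)
        head₀ []        = _
        head₀ (z<v ∷ _) = <⇒<ᵇ z<v
        z<c = All.map (All.lookup z<D) c⊆D
        hook₀ : T (isHook r₀ c)
        hook₀ = Equivalence.from (isHook⇔ r₀ c) (deleteAll-sorted c b↑ , c↑ ,
          subst (λ r → T (headLt r c)) (sym (deleteAll-head c b′ z<c)) (head₀ z<c) ,
          subst T (sym (hasContent-cong m α (r₀ ++ c) b (λ v → count-↭ v (↭-trans (++-comm r₀ c) (↭-sym b↭))))) b-content)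

      sublist-fiber : ∀ {i c} → i ≤ n → c ∈ sublists D → length c ≡ n ∸ i →
                      ∑[ r ← words i m ] 𝟙 (isHook r c) ≡ 1
      sublist-fiber {i} {c} i≤n c∈ length-c with deleted-row i≤n c∈ length-c
      ... | r₀∈ , hook₀ = trans (∑-single (words i m) _ (words-unique i m) r₀∈ λ r∈ r≢r₀ → 𝟙-false λ hook →
        r≢r₀ (hook-row-unique (letters-words i m r∈) (letters-words i m r₀∈) c-letters hook hook₀)) (𝟙-true hook₀)
        where c-letters = All.map (All.lookup b-letters ∘ ascentTops-⊆ b↑) (sublists-⊆ D c∈)

      hook-column-⊆ : ∀ {i j r c} → 1 ≤ i → r ∈ words i m → c ∈ words j m → T (isHook r c) → c ∈ sublists D
      hook-column-⊆ {c = []} _ _ _ _ = []∈sublists D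
      hook-column-⊆ {i} {r = []} 1≤i r∈ _ _ = contradiction (length-words i m r∈) (<⇒≢ 1≤i)
      hook-column-⊆ {i} {j} {z′ ∷ r′} {v₁ ∷ c′} 1≤i r∈ c∈ hook with Equivalence.to (isHook⇔ (z′ ∷ r′) (v₁ ∷ c′)) hook
      ... | r↑ , c↑ , z′<v₁ , content =
        ∈-sublists D D↑ c↑ (All.tabulate λ v∈c → ascentTops-complete b↑ (in-b (∈-++⁺ʳ (z′ ∷ r′) v∈c)) (z<c v∈c))
        where
        in-b : ∀ {v} → v ∈ (z′ ∷ r′) ++ v₁ ∷ c′ → v ∈ b
        in-b {v} v∈ = count-pos⇒∈ b (≤-trans (∈⇒count-pos v∈)
          (≤-reflexive (same-content m α (All.++⁺ (letters-words i m r∈) (letters-words j m c∈)) b-letters content b-content v)))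
        z≤z′ : z ≤ z′
        z≤z′ with in-b (here refl)
        ... | here refl = ≤-refl
        ... | there z′∈ = All.lookup (AllPairs.head b↑) z′∈
        z<c : ∀ {v} → v ∈ v₁ ∷ c′ → z < v
        z<c (here refl) = ≤-<-trans z≤z′ (<ᵇ⇒< z′ v₁ z′<v₁)
        z<c (there v∈)  = <-trans (≤-<-trans z≤z′ (<ᵇ⇒< z′ v₁ z′<v₁)) (All.lookup (AllPairs.head c↑) v∈)

      fiber : ∀ {i c} → 1 ≤ i → i ≤ n → c ∈ words (n ∸ i) m →
              ∑[ r ← words i m ] 𝟙 (isHook r c) ≡ 𝟙 (does (c ∈? sublists D))
      fiber {i} {c} 1≤i i≤n c∈ with c ∈? sublists D
      ... | yes c∈D = sublist-fiber i≤n c∈D (length-words (n ∸ i) m c∈)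
      ... | no  c∉D = ∑-zero (words i m) (λ r∈ → 𝟙-false (c∉D ∘ hook-column-⊆ {j = n ∸ i} 1≤i r∈ c∈))

      hookCoeff≡sublists : ∀ {i} → 1 ≤ i → i ≤ n → hookCoeff n i m α ≡ ∑[ c ← sublists D ] 𝟙 (length c ≡ᵇ n ∸ i)
      hookCoeff≡sublists {i} 1≤i i≤n = begin
          hookCoeff n i m α
        ≡⟨ hookCoeff≡∑ n i m α ⟩
          ∑[ r ← words i m ] ∑[ c ← C ] 𝟙 (isHook r c)
        ≡⟨ ∑-comm (words i m) C _ ⟩
          ∑[ c ← C ] ∑[ r ← words i m ] 𝟙 (isHook r c)
        ≡⟨ ∑-cong C (fiber 1≤i i≤n) ⟩
          ∑[ c ← C ] 𝟙 (does (c ∈? sublists D))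
        ≡⟨ ∑-∈?-comm (≡-dec _≟_) (words-unique (n ∸ i) m) (sublists-unique D D↑) ⟩
          ∑[ c ← sublists D ] 𝟙 (does (c ∈? C))
        ≡⟨ ∑-cong (sublists D) (λ c∈ → cong 𝟙 (∈-columns c∈)) ⟩
          ∑[ c ← sublists D ] 𝟙 (length c ≡ᵇ n ∸ i) ∎
        where
        open ≡-Reasoning
        C = words (n ∸ i) m
        ∈-columns : ∀ {c} → c ∈ sublists D → does (c ∈? C) ≡ (length c ≡ᵇ n ∸ i)
        ∈-columns {c} c∈ with length c ≟ n ∸ i
        ... | yes c≡ = trans (dec-true (c ∈? C) (∈-words⁺ c≡ (All.map (All.lookup b-letters ∘ ascentTops-⊆ b↑) (sublists-⊆ D c∈))))
                             (sym (dec-true (length c ≟ n ∸ i) c≡))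
        ... | no  c≢ = trans (dec-false (c ∈? C) (c≢ ∘ length-words (n ∸ i) m)) (sym (dec-false (length c ≟ n ∸ i) c≢))

  sortInc-++-words : ∀ {i n m r c} → i ≤ n → r ∈ words i m → c ∈ words (n ∸ i) m → sortInc (r ++ c) ∈ words n m
  sortInc-++-words {i} {n} {m} {r} {c} i≤n r∈ c∈ = ∈-words⁺
    (trans (↭-length rc↭) (trans (length-++ r) (trans (cong₂ _+_ (length-words i m r∈) (length-words (n ∸ i) m c∈)) (m+[n∸m]≡n i≤n))))
    (All-resp-↭ (↭-sym rc↭) (All.++⁺ (letters-words i m r∈) (letters-words (n ∸ i) m c∈)))
    where rc↭ = sortInc-↭ (r ++ c)

  hasContent-sortInc : ∀ m α w → hasContent m α (sortInc w) ≡ hasContent m α w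
  hasContent-sortInc m α w = hasContent-cong m α (sortInc w) w (λ v → count-↭ v (sortInc-↭ w))

  module _ (x m : ℕ) (α : Fin m → ℕ) where

    private
      K = suc x
      n = suc K
      term : List ℕ → ℕ
      term b = weight K b * 𝟙 (hasContent m α b)
      SortedWithContent : List ℕ → Set
      SortedWithContent b = Sorted b × T (hasContent m α b)
      hookSum : ℕ
      hookSum = ∑[ i ← vals n ] (x ^ (i ∸ 1) * hookCoeff n i m α)

    term-zero : ∀ {b} → ¬ SortedWithContent b → term b ≡ 0
    term-zero {b} ¬sc with T? (hasContent m α b)
    ... | yes content = cong (_* _) (weight-unsorted K b (λ b↑ → ¬sc (b↑ , content)))
    ... | no  ¬content = trans (cong (weight K b *_) (𝟙-false ¬content)) (*-zeroʳ (weight K b))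

    ∑-weights-sorted : ∀ {z b′} → z ∷ b′ ∈ words n m → SortedWithContent (z ∷ b′) →
                       ∑ (words n m) term ≡ K * hookSum
    ∑-weights-sorted {z} {b′} b∈ (b↑ , content) = begin
        ∑ (words n m) term
      ≡⟨ ∑-single (words n m) term (words-unique n m) b∈ others ⟩
        weight K b * 𝟙 (hasContent m α b)
      ≡⟨ trans (cong (weight K b *_) (𝟙-true content)) (*-identityʳ _) ⟩
        weight K b
      ≡⟨ weight-sorted x z b′ b↑ ⟩
        K * sublistPolynomial x (length b′) D
      ≡⟨ cong (λ k → K * sublistPolynomial x k D) length-b′ ⟩
        K * sublistPolynomial x K D
      ≡⟨ cong (K *_) (sym (∑-powers x K D (≤-trans (length-ascentTops z b′) (≤-reflexive length-b′)))) ⟩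
        K * ∑[ i ← vals n ] (x ^ (i ∸ 1) * ∑[ c ← sublists D ] 𝟙 (length c ≡ᵇ n ∸ i))
      ≡⟨ cong (K *_) (∑-cong (vals n) (λ {i} i∈ → cong (x ^ (i ∸ 1) *_) (sym
           (HookExpansion.hookCoeff≡sublists m α n b∈ b↑ content (proj₁ (∈-vals⁻ i∈)) (proj₂ (∈-vals⁻ i∈)))))) ⟩
        K * hookSum ∎
      where
      open ≡-Reasoning
      b = z ∷ b′
      D = ascentTops b
      length-b′ : length b′ ≡ K
      length-b′ = suc-injective (length-words n m b∈)
      others : ∀ {b″} → b″ ∈ words n m → b″ ≢ b → term b″ ≡ 0
      others b″∈ b″≢b = term-zero λ (b″↑ , content″) → b″≢b (sorted-unique b″↑ b↑
        (same-content m α (letters-words n m b″∈) (letters-words n m b∈) content″ content))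

    ∑-weights-none : (∀ {b} → b ∈ words n m → ¬ SortedWithContent b) → ∑ (words n m) term ≡ K * hookSum
    ∑-weights-none none = begin
      ∑ (words n m) term   ≡⟨ ∑-zero (words n m) (term-zero ∘ none) ⟩
      0                    ≡⟨ sym (*-zeroʳ K) ⟩
      K * 0                ≡⟨ cong (K *_) (sym (∑-zero (vals n) λ {i} i∈ →
                                trans (cong (x ^ (i ∸ 1) *_) (no-hooks i∈)) (*-zeroʳ (x ^ (i ∸ 1))))) ⟩
      K * hookSum          ∎
      where
      open ≡-Reasoning
      no-hooks : ∀ {i} → i ∈ vals n → hookCoeff n i m α ≡ 0
      no-hooks {i} i∈ = trans (hookCoeff≡∑ n i m α)
        (∑-zero (words i m) λ {r} r∈ → ∑-zero (words (n ∸ i) m) λ {c} c∈ → 𝟙-false λ hook →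
          none (sortInc-++-words (proj₂ (∈-vals⁻ i∈)) r∈ c∈)
               (sortInc-sorted (r ++ c) , subst T (sym (hasContent-sortInc m α (r ++ c))) (proj₂ (Equivalence.to T-∧ hook))))

    ∑-weights≡hookSum : ∑ (words n m) term ≡ K * hookSum
    ∑-weights≡hookSum with any? (λ b → allPairs? _≤?_ b ×-dec T? (hasContent m α b)) (words n m)
    ... | no  ∄ = ∑-weights-none (λ b∈ sc → ∄ (lose b∈ sc))
    ... | yes ∃ with find ∃
    ...   | z ∷ b′ , b∈ , sc = ∑-weights-sorted b∈ sc
    ...   | []     , b∈ , _  = contradiction (length-words n m b∈) λ ()

open import Data.Nat using (ℕ; _≤_; _∸_)
open import Data.Fin using (Fin)
open import Data.List using (List; map; upTo)
open import Data.List.Relation.Unary.Unique.Propositional using (Unique)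
open import Data.List.Membership.Propositional using (_∈_)
open import Data.Integer using (ℤ; +_; _-_; _*_; _^_)
open import Function.Bundles using (_⇔_)
open import Relation.Binary.PropositionalEquality using (_≡_)

open import Data.Nat using (zero; suc; s≤s; z≤n)
open import Data.List using ([]; _∷_)
open import Data.List.Properties using (map-cong)
open import Data.List.Relation.Unary.All using ([]; _∷_)
open import Data.List.Relation.Unary.AllPairs using ([]; _∷_)
open import Data.List.Relation.Unary.Any using (here)
open import Data.Product using (_,_)
open import Function.Bundles using (mk⇔; Equivalence)
open import Relation.Binary.PropositionalEquality using (refl; sym; trans; cong; module ≡-Reasoning)
import Data.Integer as ℤ
import Data.Integer.Properties as ℤ
import Data.Nat as ℕ
import Data.Nat.Properties as ℕ

open Counting

sumℤ-+ : {A : Set} (f : A → ℕ) (xs : List A) → sumℤ (map (λ x → + f x) xs) ≡ + ∑ xs f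
sumℤ-+ f []       = refl
sumℤ-+ f (x ∷ xs) = cong (ℤ._+_ (+ f x)) (sumℤ-+ f xs)

pos-^ : ∀ x k → (+ x) ^ k ≡ + (x ℕ.^ k)
pos-^ x zero    = refl
pos-^ x (suc k) = trans (cong (+ x *_) (pos-^ x k)) (sym (ℤ.pos-* x (x ℕ.^ k)))

sumℤ-powers-hookCoeff : ∀ x m α → let n = suc (suc x) in
  sumℤ (map (λ i → ((+ n - + 2) ^ (i ∸ 1)) * + hookCoeff n i m α) (vals n))
    ≡ + ∑[ i ← vals n ] (x ℕ.^ (i ∸ 1) ℕ.* hookCoeff n i m α)
sumℤ-powers-hookCoeff x m α = trans
  (cong sumℤ (map-cong (λ i → trans (cong (_* + hookCoeff n i m α) (pos-^ x (i ∸ 1))) (sym (ℤ.pos-* (x ℕ.^ (i ∸ 1)) _))) (vals n)))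
  (sumℤ-+ (λ i → x ℕ.^ (i ∸ 1) ℕ.* hookCoeff n i m α) (vals n))
  where n = suc (suc x)

IsPPF-1 : ∀ π → IsPPF 1 π ⇔ π ≡ 1 ∷ []
IsPPF-1 π = mk⇔ (to π) (λ { refl → refl , _ , _ })
  where
  to : ∀ π → IsPPF 1 π → π ≡ 1 ∷ []
  to (x ∷ []) (_ , park , _) with Equivalence.to (isParking⇔ (x ∷ [])) park
  ... | 1≤x ∷ _ , counts with count≤-pos (x ∷ []) (counts 1 ℕ.≤-refl ℕ.≤-refl)
  ...   | _ , here refl , x≤1 = cong (_∷ []) (ℕ.≤-antisym x≤1 1≤x)

theorem6p2-one : (L : List (List ℕ)) → Unique L → (∀ π → (π ∈ L) ⇔ IsPPF 1 π) → (m : ℕ) (α : Fin m → ℕ) →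
  sumℤ (map (λ π → + FCoeff 1 (Tie π) m α) L)
    ≡ sumℤ (map (λ i → ((+ 1 - + 2) ^ (i ∸ 1)) * + hookCoeff 1 i m α) (vals 1))
theorem6p2-one L L! L⇔PPF m α = begin
    sumℤ (map (λ π → + FCoeff 1 (Tie π) m α) L)
  ≡⟨ sumℤ-+ _ L ⟩
    + ∑[ π ← L ] FCoeff 1 (Tie π) m α
  ≡⟨ cong +_ (∑-unique-bag L! ([] ∷ []) L≈[1] _) ⟩
    + (FCoeff 1 (Tie (1 ∷ [])) m α ℕ.+ 0)
  ≡⟨ cong +_ (trans (ℕ.+-identityʳ _) (FCoeff-1≡hookCoeff _ m α)) ⟩
    + hookCoeff 1 1 m α
  ≡⟨ sym (trans (ℤ.+-identityʳ _) (ℤ.*-identityˡ _)) ⟩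
    sumℤ (map (λ i → ((+ 1 - + 2) ^ (i ∸ 1)) * + hookCoeff 1 i m α) (vals 1)) ∎
  where
  open ≡-Reasoning
  L≈[1] : ∀ π → π ∈ L ⇔ π ∈ (1 ∷ []) ∷ []
  L≈[1] π = mk⇔ (λ π∈ → here (Equivalence.to (IsPPF-1 π) (Equivalence.to (L⇔PPF π) π∈)))
                (λ { (here refl) → Equivalence.from (L⇔PPF π) (Equivalence.from (IsPPF-1 π) refl) })

theorem6p2 : (n : ℕ) → 1 ≤ n →
  (L : List (List ℕ)) → Unique L → (∀ π → (π ∈ L) ⇔ IsPPF n π) →
  (m : ℕ) (α : Fin m → ℕ) →
  sumℤ (map (λ π → + FCoeff n (Tie π) m α) L)
    ≡ sumℤ (map (λ i → ((+ n - + 2) ^ (i ∸ 1)) * + hookCoeff n i m α)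
                (vals n))
theorem6p2 (suc zero)    _ = theorem6p2-one
theorem6p2 (suc (suc x)) _ L L! L⇔PPF m α = begin
    sumℤ (map (λ π → + FCoeff (suc K) (Tie π) m α) L)
  ≡⟨ sumℤ-+ _ L ⟩
    + ∑[ π ← L ] FCoeff (suc K) (Tie π) m α
  ≡⟨ cong +_ (ℕ.*-cancelˡ-≡ _ _ K (trans (K*∑-PPF-FCoeff K (s≤s z≤n) L L! L⇔PPF m α) (∑-weights≡hookSum x m α))) ⟩
    + ∑[ i ← vals (suc K) ] (x ℕ.^ (i ∸ 1) ℕ.* hookCoeff (suc K) i m α)
  ≡⟨ sym (sumℤ-powers-hookCoeff x m α) ⟩
    sumℤ (map (λ i → ((+ suc K - + 2) ^ (i ∸ 1)) * + hookCoeff (suc K) i m α) (vals (suc K))) ∎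
  where
  open ≡-Reasoning
  K = suc x
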